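{- Let $\lambda$ be a partition of $n$. Then $$\sum_{\substack{\sigma\in\mathcal M_2(\lambda')\\ \sigma\ \mathsf{mixinv}\text{ -non-attacking}}}(-1)^{m(\sigma)}t^{n-p(\sigma)-\mathsf{mixinv}(\sigma)}q^{\mathsf{maj}(\sigma)}x^{|\sigma|} =\sum_{\substack{\tau\in\mathcal T(\lambda')\cap\mathcal M_2(\lambda')\\ \tau\ \mathsf{mixinv}\text{ -non-attacking}}}q^{\mathsf{maj}(\tau)}t^{ -\mathsf{mixinv}(\tau)}x^\tau \prod_{\substack{z:\ \tau(z)=\tau(\mathsf{South}(z))\\ z\notin\text{row }1}}\bigl(1-q^{\mathsf{leg}(z)+1}t^{1+\mathsf{arm}(\mathsf{South}(z))}\bigr)\prod_{\substack{z:\ \tau(z)\ne\tau(\mathsf{South}(z))\\ \text{or } z\in\text{row }1}}(1-t).$$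
   Context: $\mathsf{dg}'(\lambda)$ has boxes $(i,j)$, $1\le j\le\ell(\lambda)$, $1\le i\le\lambda_j$ (row $i$ from the bottom; column $j$ has height $h_j=\lambda_j$). $\mathsf{South}(u)$ is the box directly below $u$; $\mathsf{leg}(u)$ the number of boxes strictly above $u$ in its column; $\mathsf{arm}(u)$ the number of boxes strictly to the right of $u$ in its row. A rectangle is a maximal set of consecutive columns of equal height. $\mathcal A=\{1,\bar1,2,\bar2,\dots\}$, totally ordered with $0,\infty$ as $0<1<\bar1<2<\bar2<\cdots<\infty$; $|i|=|\bar i|=i$; $\mathbb Z_-=\{\bar1,\bar2,\dots\}$. A super filling is a map $\sigma:\mathsf{dg}'(\lambda)\to\mathcal A$, a positive filling one with values in $\{1,2,\dots\}$; $\mathcal T(\lambda')$ is the set of positive fillings. $p(\sigma),m(\sigma)$ are the numbers of positive and negative entries, $x^{|\sigma|}=\prod_z x_{|\sigma(z)|}$. $\mathcal M_2(\lambda')$ is the set of super fillings in which, in each rectangle, the entries of row 1 are strictly decreasing from left to right. $\hat\sigma$ adds entry $0$ at $(h_j+1,j)$ and $\infty$ at $(0,j)$ in each column. $I(a,b)=1$ if $a>b$ or $a=b\in\mathbb Z_-$, else $0$; $\mathcal Q(a,b,c)=1$ iff exactly one of $I(a,b)=1$, $I(c,b)=0$, $I(a,c)=0$ holds. $\mathsf{maj}(\sigma)=\sum(\mathsf{leg}(z)+1)$ over $z$ not in row 1 with $I(\sigma(z),\sigma(\mathsf{South}(z)))=1$. A queue inversion triple: $(a,b,c)$ with $a$ at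 $(r+1,j)$, $b$ at $(r,j)$, $c$ at $(r,k)$ of $\hat\sigma$, $k>j$, $c\ne0$, $\mathcal Q(a,b,c)=1$. An inversion triple: $(a,b,c)$ with $a$ at $(r+1,j)$, $b$ at $(r,j)$, $c$ at $(r+1,k)$ of $\hat\sigma$, $k>j$, $c\ne0$, $\mathcal Q(a,b,c)=1$. $\mathsf{mixinv}(\sigma)$ = number of inversion triples with $h_j=h_k$ plus number of queue inversion triples with $h_j\ne h_k$. $\sigma$ is $\mathsf{mixinv}$-non-attacking if there are no two distinct boxes $u,v$ with $|\sigma(u)|=|\sigma(v)|$ such that (I) $u,v$ are in the same row; or (II) $u=(i+1,j)$, $v=(i,k)$ with $k>j$ and $\lambda_j>\lambda_k$; or (III) $u=(i+1,j)$, $v=(i,k)$ with $k<j$ and $\lambda_j=\lambda_k$. -}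

module Defs where

open import Level using (Level)
open import Data.Bool using (Bool; true; false; _∧_; _∨_; not; if_then_else_)
open import Data.Nat using (ℕ; zero; suc; _∸_; _≤_; _≥_; _≡ᵇ_; _<ᵇ_; _≤ᵇ_)
import Data.Nat as ℕ
open import Data.Nat.ListAction using (sum)
open import Data.Bool.ListAction using (any)
open import Data.Integer using (ℤ; +_; -[1+_])
import Data.Integer as ℤ
open import Data.Product using (_×_; _,_)
open import Data.List using (List; []; _∷_; map; concatMap; upTo; foldr; filterᵇ; length)
open import Data.List.Relation.Unary.All using (All)
open import Data.List.Relation.Unary.Linked using (Linked)
open import Algebra.Bundles using (CommutativeRing)

IsPartition : List ℕ → Set
IsPartition la = All (λ k → 1 ≤ k) la × Linked _≥_ la

-- The alphabet 𝒜 = {1, 1̄, 2, 2̄, …}.  A letter is its absolute value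
-- (≥ 1) together with a sign flag (neg = true means barred / in ℤ₋).

record Letter : Set where
  constructor mkL
  field
    abs : ℕ
    neg : Bool
open Letter public

-- position in the total order 1 < 1̄ < 2 < 2̄ < …
rank : Letter → ℕ
rank (mkL i s) = 2 ℕ.* i ℕ.+ (if s then 1 else 0)

eqL : Letter → Letter → Bool
eqL (mkL i s) (mkL j r) = (i ≡ᵇ j) ∧ (if s then r else not r)

-- entries of σ̂ : letters, plus 0 and ∞ with 0 < 𝒜 < ∞
data Ext : Set where
  zeroE : Ext
  ltr   : Letter → Ext
  infE  : Ext

gtE : Ext → Ext → Bool
gtE infE     infE     = false
gtE infE     _        = true
gtE zeroE    _        = false
gtE (ltr a)  zeroE    = true
gtE (ltr a)  (ltr b)  = rank b <ᵇ rank a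
gtE (ltr a)  infE     = false

eqNegE : Ext → Ext → Bool
eqNegE (ltr a) (ltr b) = eqL a b ∧ neg a
eqNegE _ _ = false

isZeroE : Ext → Bool
isZeroE zeroE = true
isZeroE _ = false

I : Ext → Ext → Bool
I a b = gtE a b ∨ eqNegE a b

exactlyOne : Bool → Bool → Bool → Bool
exactlyOne x y z = (x ∧ not y ∧ not z) ∨ (not x ∧ y ∧ not z) ∨ (not x ∧ not y ∧ z)

Qf : Ext → Ext → Ext → Bool
Qf a b c = exactlyOne (I a b) (not (I c b)) (not (I a c))

-- Fillings of dg'(λ): a list of columns (column j = j-th element,
-- 0-based), each column listed from row 1 (bottom) upwards.

Filling : Set
Filling = List (List Letter)

nth : {A : Set} → A → List A → ℕ → A
nth d []       _       = d
nth d (x ∷ xs) zero    = x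
nth d (x ∷ xs) (suc k) = nth d xs k

rows : ℕ → List ℕ
rows h = map suc (upTo h)

bool→ℕ : Bool → ℕ
bool→ℕ true = 1
bool→ℕ false = 0

count : {A : Set} → (A → Bool) → List A → ℕ
count p xs = length (filterᵇ p xs)

module _ (la : List ℕ) (σ : Filling) where

  ℓ : ℕ
  ℓ = length la

  ht : ℕ → ℕ
  ht j = nth 0 la j

  col : ℕ → List Letter
  col j = nth [] σ j

  -- σ(i,j), 1 ≤ i ≤ ht j
  ent : ℕ → ℕ → Letter
  ent i j = nth (mkL 0 false) (col j) (i ∸ 1)

  hat : ℕ → ℕ → Ext
  hat zero    j = infE
  hat (suc r) j = if suc r ≤ᵇ ht j then ltr (ent (suc r) j) else zeroE

  boxes : List (ℕ × ℕ)
  boxes = concatMap (λ j → map (λ i → (i , j)) (rows (ht j))) (upTo ℓ)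

  leg : ℕ × ℕ → ℕ
  leg (i , j) = ht j ∸ i

  arm : ℕ × ℕ → ℕ
  arm (i , j) = count (λ k → (j <ᵇ k) ∧ (i ≤ᵇ ht k)) (upTo ℓ)

  pStat mStat : ℕ
  pStat = count (λ { (i , j) → not (neg (ent i j)) }) boxes
  mStat = count (λ { (i , j) → neg (ent i j) }) boxes

  maj : ℕ
  maj = sum (map (λ { (i , j) →
          if (1 <ᵇ i) ∧ I (ltr (ent i j)) (ltr (ent (i ∸ 1) j))
          then leg (i , j) ℕ.+ 1 else 0 }) boxes)

  colPairs : List (ℕ × ℕ)
  colPairs = concatMap (λ k → map (λ j → (j , k)) (upTo k)) (upTo ℓ)

  -- for columns j<k and row r (0 ≤ r ≤ h_j, so that a at (r+1,j) exists):
  -- inversion triple if h_j = h_k (c at (r+1,k)), queue inversion triple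
  -- otherwise (c at (r,k)); c must be a box of σ̂ and c ≠ 0.
  triple : ℕ → ℕ → ℕ → Bool
  triple j k r =
    if ht j ≡ᵇ ht k
    then (r ℕ.+ 1 ≤ᵇ ht k ℕ.+ 1) ∧ not (isZeroE (hat (r ℕ.+ 1) k))
           ∧ Qf (hat (r ℕ.+ 1) j) (hat r j) (hat (r ℕ.+ 1) k)
    else (r ≤ᵇ ht k ℕ.+ 1) ∧ not (isZeroE (hat r k))
           ∧ Qf (hat (r ℕ.+ 1) j) (hat r j) (hat r k)

  mixinv : ℕ
  mixinv = sum (map (λ { (j , k) → count (triple j k) (upTo (ht j ℕ.+ 1)) }) colPairs)

  -- 𝓜₂: in each rectangle, row-1 entries strictly decreasing left to right
  -- (equivalently, for adjacent columns of equal height)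
  inM2 : Bool
  inM2 = not (any (λ j → (ht j ≡ᵇ ht (suc j)) ∧
                         not (rank (ent 1 (suc j)) <ᵇ rank (ent 1 j)))
                  (upTo (ℓ ∸ 1)))

  isPositive : Bool
  isPositive = not (any (λ { (i , j) → neg (ent i j) }) boxes)

  attacks : ℕ × ℕ → ℕ × ℕ → Bool
  attacks (iu , ju) (iv , jv) =
    not ((iu ≡ᵇ iv) ∧ (ju ≡ᵇ jv))
    ∧ (abs (ent iu ju) ≡ᵇ abs (ent iv jv))
    ∧ ( (iu ≡ᵇ iv)
      ∨ ((iu ≡ᵇ iv ℕ.+ 1) ∧ (ju <ᵇ jv) ∧ (ht jv <ᵇ ht ju))
      ∨ ((iu ≡ᵇ iv ℕ.+ 1) ∧ (jv <ᵇ ju) ∧ (ht ju ≡ᵇ ht jv)))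

  nonAttacking : Bool
  nonAttacking = not (any (λ u → any (attacks u) boxes) boxes)

letters : ℕ → List Letter
letters N = concatMap (λ i → mkL (suc i) false ∷ mkL (suc i) true ∷ []) (upTo N)

columns : ℕ → ℕ → List (List Letter)
columns N zero    = [] ∷ []
columns N (suc h) = concatMap (λ c → map (_∷ c) (letters N)) (columns N h)

fillings : ℕ → List ℕ → List Filling
fillings N []       = [] ∷ []
fillings N (h ∷ la) = concatMap (λ c → map (c ∷_) (fillings N la)) (columns N h)

-- The two generating functions, evaluated in a commutative ring R at
-- q, t (with inverse tinv) and x₁, x₂, … (x i = xᵢ), truncated to the
-- alphabet of absolute values ≤ N (i.e. xᵢ = 0 for i > N).

module Gen {c ℓr : Level} (R : CommutativeRing c ℓr) where
  open CommutativeRing R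

  pow : Carrier → ℕ → Carrier
  pow a zero    = 1#
  pow a (suc k) = a * pow a k

  powZ : Carrier → Carrier → ℤ → Carrier
  powZ t tinv (+ k)      = pow t k
  powZ t tinv -[1+ k ]   = pow tinv (suc k)

  Σ : {A : Set} → (A → Carrier) → List A → Carrier
  Σ f xs = foldr (λ a r → f a + r) 0# xs

  Π : {A : Set} → (A → Carrier) → List A → Carrier
  Π f xs = foldr (λ a r → f a * r) 1# xs

  module _ (q t tinv : Carrier) (x : ℕ → Carrier) (N n : ℕ) (la : List ℕ) where

    xw : Filling → Carrier
    xw σ = Π (λ { (i , j) → x (abs (ent la σ i j)) }) (boxes la σ)

    lhsTerm : Filling → Carrier
    lhsTerm σ = pow (- 1#) (mStat la σ)
              * powZ t tinv ((+ n ℤ.- + pStat la σ) ℤ.- + mixinv la σ)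
              * pow q (maj la σ) * xw σ

    boxFactor : Filling → ℕ × ℕ → Carrier
    boxFactor τ (i , j) =
      if (1 <ᵇ i) ∧ eqL (ent la τ i j) (ent la τ (i ∸ 1) j)
      then 1# - pow q (leg la τ (i , j) ℕ.+ 1) * pow t (1 ℕ.+ arm la τ (i ∸ 1 , j))
      else 1# - t

    rhsTerm : Filling → Carrier
    rhsTerm τ = pow q (maj la τ) * powZ t tinv (ℤ.- (+ mixinv la τ)) * xw τ
              * Π (boxFactor τ) (boxes la τ)

    LHS : Carrier
    LHS = Σ lhsTerm (filterᵇ (λ σ → inM2 la σ ∧ nonAttacking la σ) (fillings N la))

    RHS : Carrier
    RHS = Σ rhsTerm (filterᵇ (λ τ → isPositive la τ ∧ inM2 la τ ∧ nonAttacking la τ)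
                             (fillings N la))

-- Every super filling σ arises from exactly one positive filling τ = |σ| by choosing a sign in
-- each box, and membership in 𝓜₂ and the non-attacking condition depend only on τ: attacks
-- only see absolute values, and in a non-attacking filling adjacent row-1 entries of a
-- rectangle have distinct absolute values, so the order on 𝒜 compares them as integers.
-- For fixed τ every statistic of a signing σ is that of τ corrected box by box.  Barring the
-- entry of a box z costs −t through (−1)^m t^(n−p); if moreover |σ(z)| = |σ(South z)|, then z
-- becomes a descent worth q^(leg z + 1), and exactly arm(South z) of the triples counted by
-- mixinv(τ) disappear, worth t^(arm (South z)) against t^(−mixinv).  So the summand is a
-- product of one factor per box depending only on the sign there, and summing the two signs
-- box by box gives the factors 1 − q^(leg+1) t^(1+arm(South z)) and 1 − t of the right side.
module Submission where

open import Defs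
open import Level using (Level)
open import Data.Bool using (Bool; true; false; _∧_; _∨_; not; if_then_else_)
open import Data.Bool.Properties using (∧-zeroʳ; ∧-identityʳ; ∨-identityʳ; not-involutive)
open import Data.Bool.ListAction using (any; or)
open import Data.Nat using (ℕ; zero; suc; _≤_; _<_; _≥_; z≤n; s≤s; _≤ᵇ_; _<ᵇ_; _≡ᵇ_; _∸_)
import Data.Nat as ℕ
import Data.Nat.Properties as ℕₚ
open import Data.Nat.ListAction using (sum)
open import Data.Integer using (+_; _⊖_)
import Data.Integer as ℤ
import Data.Integer.Properties as ℤₚ
open import Data.Product using (Σ-syntax; _×_; _,_; proj₁; proj₂)
open import Data.Sum using (inj₁; inj₂)
open import Data.List using (List; []; _∷_; _++_; map; concatMap; foldr; filterᵇ; length; upTo; applyUpTo)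
open import Data.List.Properties
  using ( map-∘; map-cong; map-cong-local; map-upTo; map-concatMap; concatMap-map; concatMap-cong
        ; length-++; length-map; length-upTo; upTo-∷ʳ)
open import Data.List.Membership.Propositional using (_∈_)
open import Data.List.Membership.Propositional.Properties
  using (∈-++⁺ˡ; ∈-++⁺ʳ; ∈-map⁺; ∈-map⁻; ∈-upTo⁺; ∈-upTo⁻; ∈-concat⁻′)
open import Data.List.Relation.Unary.Any using (here; there)
open import Data.List.Relation.Unary.All as All using (All; []; _∷_)
open import Data.List.Relation.Unary.Linked as Linked using (Linked)
open import Data.List.Relation.Unary.Linked.Properties using (Linked⇒All)
open import Data.Empty using (⊥-elim)
open import Relation.Nullary using (¬_; yes; no)
open import Relation.Binary.Definitions using (tri<; tri≈; tri>)
open import Relation.Binary.PropositionalEquality as ≡ using (_≡_; _≢_)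
open import Algebra.Bundles using (CommutativeMonoid; CommutativeSemiring; CommutativeRing)

∨-introˡ : {a b : Bool} → a ≡ true → (a ∨ b) ≡ true
∨-introˡ ≡.refl = ≡.refl

∨-introʳ : {a b : Bool} → b ≡ true → (a ∨ b) ≡ true
∨-introʳ {true}  _ = ≡.refl
∨-introʳ {false} e = e

∧≡true : {a b : Bool} → (a ∧ b) ≡ true → a ≡ true × b ≡ true
∧≡true {true} b≡true = ≡.refl , b≡true

∧-middle≡false : {a b c : Bool} → (a ∧ b ∧ c) ≡ false → a ≡ true → c ≡ true → b ≡ false
∧-middle≡false {true} {false} _ _ _ = ≡.refl
∧-middle≡false {true} {true} {true} () _ _

module _ {P : Set} where
  open import Relation.Nullary.Reflects using (Reflects; ofʸ; ofⁿ)

  reflects⇒≡true : {b : Bool} → Reflects P b → P → b ≡ true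
  reflects⇒≡true (ofʸ _)  _ = ≡.refl
  reflects⇒≡true (ofⁿ ¬p) p = ⊥-elim (¬p p)

  reflects⇒≡false : {b : Bool} → Reflects P b → ¬ P → b ≡ false
  reflects⇒≡false (ofʸ p) ¬p = ⊥-elim (¬p p)
  reflects⇒≡false (ofⁿ _) _  = ≡.refl

  reflects-≡true⇒ : {b : Bool} → Reflects P b → b ≡ true → P
  reflects-≡true⇒ (ofʸ p) _ = p

  reflects-≡false⇒ : {b : Bool} → Reflects P b → b ≡ false → ¬ P
  reflects-≡false⇒ (ofⁿ ¬p) _ = ¬p

module _ {m n : ℕ} where
  open import Relation.Nullary.Reflects using (Reflects; fromEquivalence)

  ≡ᵇ-reflects-≡ : Reflects (m ≡ n) (m ≡ᵇ n)
  ≡ᵇ-reflects-≡ = fromEquivalence (ℕₚ.≡ᵇ⇒≡ m n) (ℕₚ.≡⇒≡ᵇ m n)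

  ≡ᵇ≡true : m ≡ n → (m ≡ᵇ n) ≡ true
  ≡ᵇ≡true = reflects⇒≡true ≡ᵇ-reflects-≡

  ≡ᵇ≡false : m ≢ n → (m ≡ᵇ n) ≡ false
  ≡ᵇ≡false = reflects⇒≡false ≡ᵇ-reflects-≡

  ≡ᵇ≡true⇒≡ : (m ≡ᵇ n) ≡ true → m ≡ n
  ≡ᵇ≡true⇒≡ = reflects-≡true⇒ ≡ᵇ-reflects-≡

  ≡ᵇ≡false⇒≢ : (m ≡ᵇ n) ≡ false → m ≢ n
  ≡ᵇ≡false⇒≢ = reflects-≡false⇒ ≡ᵇ-reflects-≡

  ≤ᵇ≡true : m ≤ n → (m ≤ᵇ n) ≡ true
  ≤ᵇ≡true = reflects⇒≡true (ℕₚ.≤ᵇ-reflects-≤ m n)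

  ≤ᵇ≡false : n < m → (m ≤ᵇ n) ≡ false
  ≤ᵇ≡false n<m = reflects⇒≡false (ℕₚ.≤ᵇ-reflects-≤ m n) (ℕₚ.<⇒≱ n<m)

  <ᵇ≡true : m < n → (m <ᵇ n) ≡ true
  <ᵇ≡true = reflects⇒≡true (ℕₚ.<ᵇ-reflects-< m n)

  <ᵇ≡false : n ≤ m → (m <ᵇ n) ≡ false
  <ᵇ≡false n≤m = reflects⇒≡false (ℕₚ.<ᵇ-reflects-< m n) (ℕₚ.≤⇒≯ n≤m)

≡ᵇ-sym : (m n : ℕ) → (m ≡ᵇ n) ≡ (n ≡ᵇ m)
≡ᵇ-sym zero    zero    = ≡.refl
≡ᵇ-sym zero    (suc n) = ≡.refl
≡ᵇ-sym (suc m) zero    = ≡.refl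
≡ᵇ-sym (suc m) (suc n) = ≡ᵇ-sym m n

<ᵇ-asym : (m n : ℕ) → m ≢ n → (m <ᵇ n) ≡ not (n <ᵇ m)
<ᵇ-asym m n m≢n with ℕₚ.<-cmp m n
... | tri< m<n _ _ = ≡.trans (<ᵇ≡true m<n) (≡.cong not (≡.sym (<ᵇ≡false (ℕₚ.<⇒≤ m<n))))
... | tri≈ _ m≡n _ = ⊥-elim (m≢n m≡n)
... | tri> _ _ n<m = ≡.trans (<ᵇ≡false (ℕₚ.<⇒≤ n<m)) (≡.cong not (≡.sym (<ᵇ≡true n<m)))

any≡false⇒nth : {A : Set} (p : A → Bool) (d : A) → p d ≡ false →
  (xs : List A) → any p xs ≡ false → ∀ k → p (nth d xs k) ≡ false
any≡false⇒nth p d pd []       _ k = pd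
any≡false⇒nth p d pd (x ∷ xs) e k with p x in px | k
... | false | zero  = px
... | false | suc k = any≡false⇒nth p d pd xs e k

any≡false⇒∈ : {A : Set} (p : A → Bool) {xs : List A} → any p xs ≡ false → ∀ {x} → x ∈ xs → p x ≡ false
any≡false⇒∈ p {y ∷ ys} e x∈ with p y in py | x∈
... | false | here ≡.refl = py
... | false | there x∈ys = any≡false⇒∈ p e x∈ys

any-++ : {A : Set} (p : A → Bool) (xs ys : List A) → any p (xs ++ ys) ≡ (any p xs ∨ any p ys)
any-++ p []       ys = ≡.refl
any-++ p (x ∷ xs) ys with p x
... | true  = ≡.refl
... | false = any-++ p xs ys

any-map : {A B : Set} (p : B → Bool) (f : A → B) (xs : List A) → any p (map f xs) ≡ any (λ a → p (f a)) xs
any-map p f []       = ≡.refl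
any-map p f (x ∷ xs) = ≡.cong (p (f x) ∨_) (any-map p f xs)

nth-All : {P : ℕ → Set} (la : List ℕ) → All P la → ∀ {j} → j < length la → P (nth 0 la j)
nth-All (h ∷ la) (ph ∷ _)  {zero}  _         = ph
nth-All (h ∷ la) (_ ∷ pla) {suc j} (s≤s j<ℓ) = nth-All la pla j<ℓ

nth-≤ : {h : ℕ} (la : List ℕ) → All (_≤ h) la → ∀ k → nth 0 la k ≤ h
nth-≤ []       _           k       = z≤n
nth-≤ (_ ∷ la) (p ∷ _)     zero    = p
nth-≤ (_ ∷ la) (_ ∷ ps)    (suc k) = nth-≤ la ps k

linked-≥⇒antitone : {la : List ℕ} → Linked _≥_ la → ∀ {j k} → j < k → nth 0 la k ≤ nth 0 la j
linked-≥⇒antitone {[]}     _ _                           = z≤n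
linked-≥⇒antitone {h ∷ la} l {zero}  {suc k} _         =
  nth-≤ la (All.tail (Linked⇒All (λ x≥y y≥z → ℕₚ.≤-trans y≥z x≥y) ℕₚ.≤-refl l)) k
linked-≥⇒antitone {h ∷ la} l {suc j} {suc k} (s≤s j<k) = linked-≥⇒antitone (Linked.tail l) j<k

∈-concatMap-map⁻ : {A B C : Set} (g : A → B → C) (xs : List A) (ys : List B) {z : C} →
  z ∈ concatMap (λ a → map (g a) ys) xs → Σ[ a ∈ A ] Σ[ b ∈ B ] (a ∈ xs × b ∈ ys × z ≡ g a b)
∈-concatMap-map⁻ g xs ys z∈ with ∈-concat⁻′ (map _ xs) z∈
... | zs , z∈zs , zs∈ with ∈-map⁻ _ zs∈
... | a , a∈xs , ≡.refl with ∈-map⁻ (g a) z∈zs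
... | b , b∈ys , z≡gab = a , b , a∈xs , b∈ys , z≡gab

module ListFold {c ℓ} (M : CommutativeMonoid c ℓ) where
  open CommutativeMonoid M
  open import Algebra.Properties.CommutativeSemigroup commutativeSemigroup using (interchange)

  fold : {A : Set} → (A → Carrier) → List A → Carrier
  fold f = foldr (λ a r → f a ∙ r) ε

  fold-cong∈ : {A : Set} {f g : A → Carrier} (xs : List A) →
    (∀ a → a ∈ xs → f a ≈ g a) → fold f xs ≈ fold g xs
  fold-cong∈ []       f≈g = refl
  fold-cong∈ (x ∷ xs) f≈g = ∙-cong (f≈g x (here ≡.refl)) (fold-cong∈ xs (λ a a∈xs → f≈g a (there a∈xs)))

  fold-cong : {A : Set} {f g : A → Carrier} (xs : List A) → (∀ a → f a ≈ g a) → fold f xs ≈ fold g xs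
  fold-cong xs f≈g = fold-cong∈ xs (λ a _ → f≈g a)

  fold-++ : {A : Set} (f : A → Carrier) (xs ys : List A) → fold f (xs ++ ys) ≈ fold f xs ∙ fold f ys
  fold-++ f []       ys = sym (identityˡ _)
  fold-++ f (x ∷ xs) ys = trans (∙-cong refl (fold-++ f xs ys)) (sym (assoc _ _ _))

  fold-map : {A B : Set} (f : B → Carrier) (g : A → B) (xs : List A) →
    fold f (map g xs) ≡ fold (λ a → f (g a)) xs
  fold-map f g []       = ≡.refl
  fold-map f g (x ∷ xs) = ≡.cong (f (g x) ∙_) (fold-map f g xs)

  fold-concatMap : {A B : Set} (f : B → Carrier) (g : A → List B) (xs : List A) →
    fold f (concatMap g xs) ≈ fold (λ a → fold f (g a)) xs
  fold-concatMap f g []       = refl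
  fold-concatMap f g (x ∷ xs) = trans (fold-++ f (g x) (concatMap g xs)) (∙-cong refl (fold-concatMap f g xs))

  fold-concatMap-map : {A B C : Set} (f : C → Carrier) (g : A → B → C) (xs : List A) (ys : List B) →
    fold f (concatMap (λ a → map (g a) ys) xs) ≈ fold (λ a → fold (λ b → f (g a b)) ys) xs
  fold-concatMap-map f g xs ys =
    trans (fold-concatMap f _ xs) (fold-cong xs (λ a → reflexive (fold-map f (g a) ys)))

  fold-∙ : {A : Set} (f g : A → Carrier) (xs : List A) → fold (λ a → f a ∙ g a) xs ≈ fold f xs ∙ fold g xs
  fold-∙ f g []       = sym (identityˡ _)
  fold-∙ f g (x ∷ xs) = trans (∙-cong refl (fold-∙ f g xs)) (interchange _ _ _ _)

  fold-ε : {A : Set} (xs : List A) → fold (λ _ → ε) xs ≈ ε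
  fold-ε []       = refl
  fold-ε (x ∷ xs) = trans (identityˡ _) (fold-ε xs)

  fold-swap : {A B : Set} (f : A → B → Carrier) (xs : List A) (ys : List B) →
    fold (λ a → fold (f a) ys) xs ≈ fold (λ b → fold (λ a → f a b) xs) ys
  fold-swap f []       ys = sym (fold-ε ys)
  fold-swap f (x ∷ xs) ys = trans (∙-cong refl (fold-swap f xs ys)) (sym (fold-∙ (f x) _ ys))

module ListSum {c ℓ} (S : CommutativeSemiring c ℓ) where
  open CommutativeSemiring S
  open import Relation.Binary.Reasoning.Setoid setoid

  open ListFold +-commutativeMonoid public using ()
    renaming ( fold to ∑; fold-cong∈ to Σ-cong∈; fold-cong to Σ-cong; fold-map to Σ-map
             ; fold-concatMap to Σ-concatMap; fold-concatMap-map to Σ-concatMap-map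
             ; fold-∙ to Σ-+; fold-swap to Σ-swap)
  open ListFold *-commutativeMonoid public using ()
    renaming (fold-cong to Π-cong; fold-++ to Π-++; fold-map to Π-map; fold-∙ to Π-*)

  Σ-*ˡ : {A : Set} (k : Carrier) (f : A → Carrier) (xs : List A) → k * ∑ f xs ≈ ∑ (λ a → k * f a) xs
  Σ-*ˡ k f []       = zeroʳ k
  Σ-*ˡ k f (x ∷ xs) = trans (distribˡ k _ _) (+-cong refl (Σ-*ˡ k f xs))

  Σ-*ʳ : {A : Set} (k : Carrier) (f : A → Carrier) (xs : List A) → ∑ f xs * k ≈ ∑ (λ a → f a * k) xs
  Σ-*ʳ k f xs = trans (*-comm _ _) (trans (Σ-*ˡ k f xs) (Σ-cong xs (λ a → *-comm _ _)))

  Σ-⊗ : {A B C : Set} (f : C → Carrier) (g : A → B → C) (u : A → Carrier) (v : B → Carrier)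
    (xs : List A) (ys : List B) → (∀ a b → f (g a b) ≈ u a * v b) →
    ∑ f (concatMap (λ a → map (g a) ys) xs) ≈ ∑ u xs * ∑ v ys
  Σ-⊗ f g u v xs ys f≈uv = begin
    ∑ f (concatMap (λ a → map (g a) ys) xs) ≈⟨ Σ-concatMap-map f g xs ys ⟩
    ∑ (λ a → ∑ (λ b → f (g a b)) ys) xs    ≈⟨ Σ-cong xs (λ a → Σ-cong ys (f≈uv a)) ⟩
    ∑ (λ a → ∑ (λ b → u a * v b) ys) xs    ≈⟨ Σ-cong xs (λ a → sym (Σ-*ˡ (u a) v ys)) ⟩
    ∑ (λ a → u a * ∑ v ys) xs              ≈⟨ sym (Σ-*ʳ (∑ v ys) u xs) ⟩
    ∑ u xs * ∑ v ys                        ∎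

  ι : Bool → Carrier
  ι b = if b then 1# else 0#

  Σ-filterᵇ : {A : Set} (f : A → Carrier) (p : A → Bool) (xs : List A) →
    ∑ f (filterᵇ p xs) ≈ ∑ (λ a → ι (p a) * f a) xs
  Σ-filterᵇ f p [] = refl
  Σ-filterᵇ f p (x ∷ xs) with p x
  ... | true  = +-cong (sym (*-identityˡ _)) (Σ-filterᵇ f p xs)
  ... | false = trans (Σ-filterᵇ f p xs) (trans (sym (+-identityˡ _)) (+-cong (sym (zeroˡ _)) refl))

module Powers {c ℓ} (R : CommutativeRing c ℓ) where
  open CommutativeRing R
  open Gen R
  open import Relation.Binary.Reasoning.Setoid setoid

  pow-+ : (a : Carrier) (m n : ℕ) → pow a (m ℕ.+ n) ≈ pow a m * pow a n
  pow-+ a zero    n = sym (*-identityˡ _)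
  pow-+ a (suc m) n = trans (*-cong refl (pow-+ a m n)) (sym (*-assoc _ _ _))

  pow-sum : {A : Set} (a : Carrier) (h : A → ℕ) (xs : List A) → pow a (sum (map h xs)) ≈ Π (λ x → pow a (h x)) xs
  pow-sum a h []       = refl
  pow-sum a h (x ∷ xs) = trans (pow-+ a (h x) _) (*-cong refl (pow-sum a h xs))

  pow-count : {A : Set} (a : Carrier) (p : A → Bool) (xs : List A) →
    pow a (count p xs) ≈ Π (λ x → if p x then a else 1#) xs
  pow-count a p [] = refl
  pow-count a p (x ∷ xs) with p x
  ... | true  = *-cong refl (pow-count a p xs)
  ... | false = trans (pow-count a p xs) (sym (*-identityˡ _))

  module _ (t tinv : Carrier) (t*tinv≈1 : t * tinv ≈ 1#) where
    open import Algebra.Properties.CommutativeSemigroup *-commutativeSemigroup using (interchange)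

    pow-inverse : (k : ℕ) → pow t k * pow tinv k ≈ 1#
    pow-inverse zero    = *-identityˡ _
    pow-inverse (suc k) = begin
      (t * pow t k) * (tinv * pow tinv k) ≈⟨ interchange _ _ _ _ ⟩
      (t * tinv) * (pow t k * pow tinv k) ≈⟨ *-cong t*tinv≈1 (pow-inverse k) ⟩
      1# * 1#                             ≈⟨ *-identityˡ _ ⟩
      1#                                  ∎

    powZ-⊖ : (a b : ℕ) → powZ t tinv (a ⊖ b) ≈ pow t a * pow tinv b
    powZ-⊖ zero    zero    = sym (*-identityˡ _)
    powZ-⊖ (suc a) zero    = sym (*-identityʳ _)
    powZ-⊖ zero    (suc b) = sym (*-identityˡ _)
    powZ-⊖ (suc a) (suc b) = begin
      powZ t tinv (suc a ⊖ suc b)          ≡⟨ ≡.cong (powZ t tinv) (ℤₚ.[1+m]⊖[1+n]≡m⊖n a b) ⟩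
      powZ t tinv (a ⊖ b)                  ≈⟨ powZ-⊖ a b ⟩
      pow t a * pow tinv b                 ≈⟨ sym (*-identityˡ _) ⟩
      1# * (pow t a * pow tinv b)          ≈⟨ *-cong (sym t*tinv≈1) refl ⟩
      (t * tinv) * (pow t a * pow tinv b)  ≈⟨ interchange _ _ _ _ ⟩
      (t * pow t a) * (tinv * pow tinv b)  ∎

    powZ-[p+m]-p-k : (p m k : ℕ) → powZ t tinv ((+ (p ℕ.+ m) ℤ.- + p) ℤ.- + k) ≈ pow t m * pow tinv k
    powZ-[p+m]-p-k p m k = trans (reflexive (≡.cong (powZ t tinv) exponent)) (powZ-⊖ m k)
      where
      exponent : (+ (p ℕ.+ m) ℤ.- + p) ℤ.- + k ≡ m ⊖ k
      exponent = ≡.trans (≡.cong (ℤ._- + k) (≡.trans (ℤₚ.m-n≡m⊖n (p ℕ.+ m) p)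
                   (≡.trans (ℤₚ.⊖-≥ (ℕₚ.m≤m+n p m)) (≡.cong +_ (ℕₚ.m+n∸m≡n p m)))))
                 (ℤₚ.m-n≡m⊖n m k)

    powZ-neg : (k : ℕ) → powZ t tinv (ℤ.- (+ k)) ≡ pow tinv k
    powZ-neg zero    = ≡.refl
    powZ-neg (suc k) = ≡.refl

module ℕSum where
  open ListSum ℕₚ.+-*-commutativeSemiring public using (∑; Σ-cong∈; Σ-cong; Σ-map; Σ-concatMap; Σ-+; Σ-swap; Σ-*ˡ)
  open ListFold ℕₚ.+-0-commutativeMonoid using (fold-++)

  sum-map : {A : Set} (f : A → ℕ) (xs : List A) → sum (map f xs) ≡ ∑ f xs
  sum-map f []       = ≡.refl
  sum-map f (x ∷ xs) = ≡.cong (f x ℕ.+_) (sum-map f xs)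

  count≡∑ : {A : Set} (p : A → Bool) (xs : List A) → count p xs ≡ ∑ (λ a → bool→ℕ (p a)) xs
  count≡∑ p [] = ≡.refl
  count≡∑ p (x ∷ xs) with p x
  ... | true  = ≡.cong suc (count≡∑ p xs)
  ... | false = count≡∑ p xs

  count-not+count : {A : Set} (p : A → Bool) (xs : List A) → count (λ a → not (p a)) xs ℕ.+ count p xs ≡ length xs
  count-not+count p [] = ≡.refl
  count-not+count p (x ∷ xs) with p x
  ... | true  = ≡.trans (ℕₚ.+-suc _ _) (≡.cong suc (count-not+count p xs))
  ... | false = ≡.cong suc (count-not+count p xs)

  ∑-upTo-suc : (f : ℕ → ℕ) (ℓ : ℕ) → ∑ f (upTo (suc ℓ)) ≡ ∑ f (upTo ℓ) ℕ.+ f ℓ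
  ∑-upTo-suc f ℓ = begin
    ∑ f (upTo (suc ℓ))              ≡⟨ ≡.cong (∑ f) (upTo-∷ʳ ℓ) ⟨
    ∑ f (upTo ℓ ++ ℓ ∷ [])          ≡⟨ fold-++ f (upTo ℓ) (ℓ ∷ []) ⟩
    ∑ f (upTo ℓ) ℕ.+ (f ℓ ℕ.+ 0)    ≡⟨ ≡.cong (∑ f (upTo ℓ) ℕ.+_) (ℕₚ.+-identityʳ (f ℓ)) ⟩
    ∑ f (upTo ℓ) ℕ.+ f ℓ            ∎
    where open ≡.≡-Reasoning

  ∑-upTo-<ᵇ : (X : ℕ → ℕ) {k ℓ : ℕ} → k ≤ ℓ →
    ∑ (λ j → bool→ℕ (j <ᵇ k) ℕ.* X j) (upTo ℓ) ≡ ∑ X (upTo k)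
  ∑-upTo-<ᵇ X {k} {zero}  z≤n = ≡.refl
  ∑-upTo-<ᵇ X {k} {suc ℓ} k≤1+ℓ with ℕₚ.m≤n⇒m<n∨m≡n k≤1+ℓ
  ... | inj₁ (s≤s k≤ℓ) = begin
    ∑ Y (upTo (suc ℓ))     ≡⟨ ∑-upTo-suc Y ℓ ⟩
    ∑ Y (upTo ℓ) ℕ.+ Y ℓ   ≡⟨ ≡.cong₂ ℕ._+_ (∑-upTo-<ᵇ X k≤ℓ)
                                            (≡.cong (λ b → bool→ℕ b ℕ.* X ℓ) (<ᵇ≡false k≤ℓ)) ⟩
    ∑ X (upTo k) ℕ.+ 0     ≡⟨ ℕₚ.+-identityʳ _ ⟩
    ∑ X (upTo k)           ∎
    where
    open ≡.≡-Reasoning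
    Y = λ j → bool→ℕ (j <ᵇ k) ℕ.* X j
  ... | inj₂ ≡.refl = begin
    ∑ Y (upTo (suc ℓ))     ≡⟨ ∑-upTo-suc Y ℓ ⟩
    ∑ Y (upTo ℓ) ℕ.+ Y ℓ   ≡⟨ ≡.cong₂ ℕ._+_
                                 (Σ-cong∈ (upTo ℓ) (λ j j∈ → Y≡X (ℕₚ.≤-trans (∈-upTo⁻ j∈) (ℕₚ.n≤1+n ℓ))))
                                            (Y≡X ℕₚ.≤-refl) ⟩
    ∑ X (upTo ℓ) ℕ.+ X ℓ   ≡⟨ ∑-upTo-suc X ℓ ⟨
    ∑ X (upTo (suc ℓ))     ∎
    where
    open ≡.≡-Reasoning
    Y = λ j → bool→ℕ (j <ᵇ suc ℓ) ℕ.* X j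
    Y≡X : ∀ {j} → j < suc ℓ → Y j ≡ X j
    Y≡X {j} j<k = ≡.trans (≡.cong (λ b → bool→ℕ b ℕ.* X j) (<ᵇ≡true j<k)) (ℕₚ.+-identityʳ _)

-- Signings of a filling

signs : Letter → List Letter
signs l = mkL (abs l) false ∷ mkL (abs l) true ∷ []

columnSignings : List Letter → List (List Letter)
columnSignings []      = [] ∷ []
columnSignings (l ∷ c) = concatMap (λ c′ → map (_∷ c′) (signs l)) (columnSignings c)

signings : Filling → List Filling
signings []      = [] ∷ []
signings (c ∷ τ) = concatMap (λ c′ → map (c′ ∷_) (signings τ)) (columnSignings c)

hasNeg : Filling → Bool
hasNeg = any (any neg)

signs-abs : (l : Letter) {l′ : Letter} → l′ ∈ signs l → abs l′ ≡ abs l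
signs-abs l (here ≡.refl)         = ≡.refl
signs-abs l (there (here ≡.refl)) = ≡.refl

columnSignings-abs : (c : List Letter) {c′ : List Letter} → c′ ∈ columnSignings c →
  ∀ r → abs (nth (mkL 0 false) c′ r) ≡ abs (nth (mkL 0 false) c r)
columnSignings-abs []      (here ≡.refl) r = ≡.refl
columnSignings-abs (l ∷ c) c′∈ r with ∈-concatMap-map⁻ (λ c₀ l′ → l′ ∷ c₀) (columnSignings c) (signs l) c′∈ | r
... | c₀ , l′ , c₀∈ , l′∈ , ≡.refl | zero  = signs-abs l l′∈
... | c₀ , l′ , c₀∈ , l′∈ , ≡.refl | suc r = columnSignings-abs c c₀∈ r

signings-abs : (la : List ℕ) (τ : Filling) {σ : Filling} → σ ∈ signings τ →
  ∀ i j → abs (ent la σ i j) ≡ abs (ent la τ i j)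
signings-abs la []      (here ≡.refl) i j = ≡.refl
signings-abs la (c ∷ τ) σ∈ i j with ∈-concatMap-map⁻ _∷_ (columnSignings c) (signings τ) σ∈ | j
... | c′ , σ′ , c′∈ , σ′∈ , ≡.refl | zero  = columnSignings-abs c c′∈ (i ∸ 1)
... | c′ , σ′ , c′∈ , σ′∈ , ≡.refl | suc j = signings-abs la τ σ′∈ i j

hasNeg≡false⇒nonNeg : (la : List ℕ) (τ : Filling) → hasNeg τ ≡ false → ∀ i j → neg (ent la τ i j) ≡ false
hasNeg≡false⇒nonNeg la τ e i j =
  any≡false⇒nth neg (mkL 0 false) ≡.refl (nth [] τ j) (any≡false⇒nth (any neg) [] ≡.refl τ e j) (i ∸ 1)

firstColumn : ℕ → List (ℕ × ℕ)
firstColumn h = map (λ r → (suc r , 0)) (upTo h)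

shiftRight : ℕ × ℕ → ℕ × ℕ
shiftRight (i , j) = (i , suc j)

-- `boxes la σ` does not depend on σ.
dg : List ℕ → List (ℕ × ℕ)
dg la = boxes la []

dg-∷ : (h : ℕ) (la : List ℕ) → dg (h ∷ la) ≡ firstColumn h ++ map shiftRight (dg la)
dg-∷ h la = ≡.cong₂ _++_ (≡.sym (map-∘ (upTo h))) (begin
  concatMap F (applyUpTo suc L)   ≡⟨ ≡.cong (concatMap F) (≡.sym (map-upTo suc L)) ⟩
  concatMap F (map suc (upTo L))            ≡⟨ concatMap-map F suc (upTo L) ⟩
  concatMap (λ j → F (suc j)) (upTo L)      ≡⟨ concatMap-cong (λ j → map-∘ (rows (nth 0 la j))) (upTo L) ⟩
  concatMap (λ j → map shiftRight (G j)) (upTo L) ≡⟨ map-concatMap shiftRight G (upTo L) ⟨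
  map shiftRight (dg la)                    ∎)
  where
  open ≡.≡-Reasoning
  L = length la
  F G : ℕ → List (ℕ × ℕ)
  F j = map (λ i → (i , j)) (rows (nth 0 (h ∷ la) j))
  G j = map (λ i → (i , j)) (rows (nth 0 la j))

length-dg : (la : List ℕ) → length (dg la) ≡ sum la
length-dg []       = ≡.refl
length-dg (h ∷ la) = begin
  length (dg (h ∷ la))                                     ≡⟨ ≡.cong length (dg-∷ h la) ⟩
  length (firstColumn h ++ map shiftRight (dg la))          ≡⟨ length-++ (firstColumn h) ⟩
  length (firstColumn h) ℕ.+ length (map shiftRight (dg la))
    ≡⟨ ≡.cong₂ ℕ._+_ (≡.trans (length-map _ (upTo h)) (length-upTo h))
                     (≡.trans (length-map shiftRight (dg la)) (length-dg la)) ⟩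
  h ℕ.+ sum la                                             ∎
  where open ≡.≡-Reasoning

∈-dg : (la : List ℕ) {i j : ℕ} → 1 ≤ i → i ≤ nth 0 la j → (i , j) ∈ dg la
∈-dg (h ∷ la) {suc r} {zero}  (s≤s _) r<h rewrite dg-∷ h la =
  ∈-++⁺ˡ (∈-map⁺ (λ r → (suc r , 0)) (∈-upTo⁺ r<h))
∈-dg (h ∷ la) {i}     {suc j} 1≤i     i≤h rewrite dg-∷ h la =
  ∈-++⁺ʳ (firstColumn h) (∈-map⁺ shiftRight (∈-dg la 1≤i i≤h))

data Shape : List ℕ → Filling → Set where
  []ˢ  : Shape [] []
  _∷ˢ_ : {h : ℕ} {la : List ℕ} {c : List Letter} {τ : Filling} →
         length c ≡ h → Shape la τ → Shape (h ∷ la) (c ∷ τ)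

columns-length : (N h : ℕ) {c : List Letter} → c ∈ columns N h → length c ≡ h
columns-length N zero    (here ≡.refl) = ≡.refl
columns-length N (suc h) c∈ with ∈-concatMap-map⁻ (λ c₀ l → l ∷ c₀) (columns N h) (letters N) c∈
... | c₀ , l , c₀∈ , l∈ , ≡.refl = ≡.cong suc (columns-length N h c₀∈)

fillings-shape : (N : ℕ) (la : List ℕ) {τ : Filling} → τ ∈ fillings N la → Shape la τ
fillings-shape N []       (here ≡.refl) = []ˢ
fillings-shape N (h ∷ la) τ∈ with ∈-concatMap-map⁻ _∷_ (columns N h) (fillings N la) τ∈
... | c , τ′ , c∈ , τ′∈ , ≡.refl = columns-length N h c∈ ∷ˢ fillings-shape N la τ′∈

signAt : List ℕ → Filling → ℕ × ℕ → Bool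
signAt la σ (i , j) = neg (ent la σ i j)

any-signAt-dg : (la : List ℕ) (τ : Filling) → Shape la τ → any (signAt la τ) (dg la) ≡ hasNeg τ
any-signAt-dg []       []      []ˢ             = ≡.refl
any-signAt-dg (h ∷ la) (c ∷ τ) (≡.refl ∷ˢ s) = begin
  any (signAt (h ∷ la) (c ∷ τ)) (dg (h ∷ la))
    ≡⟨ ≡.cong (any _) (dg-∷ h la) ⟩
  any (signAt (h ∷ la) (c ∷ τ)) (firstColumn h ++ map shiftRight (dg la))
    ≡⟨ any-++ _ (firstColumn h) _ ⟩
  any (signAt (h ∷ la) (c ∷ τ)) (firstColumn h) ∨ any (signAt (h ∷ la) (c ∷ τ)) (map shiftRight (dg la))
    ≡⟨ ≡.cong₂ _∨_ (≡.trans (any-map _ _ (upTo h)) (column c))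
                   (≡.trans (any-map _ shiftRight (dg la)) (any-signAt-dg la τ s)) ⟩
  any neg c ∨ hasNeg τ ∎
  where
  open ≡.≡-Reasoning
  column : (c : List Letter) → any (λ r → neg (nth (mkL 0 false) c r)) (upTo (length c)) ≡ any neg c
  column []      = ≡.refl
  column (l ∷ c) = ≡.cong (neg l ∨_) (≡.trans (≡.cong (any _) (≡.sym (map-upTo suc (length c))))
                                      (≡.trans (any-map _ suc (upTo (length c))) (column c)))

isPositive≡not-hasNeg : (la : List ℕ) (τ : Filling) → Shape la τ → isPositive la τ ≡ not (hasNeg τ)
isPositive≡not-hasNeg la τ s = ≡.cong not (any-signAt-dg la τ s)

module SumOverSignings {c ℓ} (R : CommutativeRing c ℓ) where
  open CommutativeRing R
  open Gen R
  open ListSum commutativeSemiring hiding (∑)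
  open import Relation.Binary.Reasoning.Setoid setoid

  ι-not-∨ : (a b : Bool) → ι (not (a ∨ b)) ≈ ι (not a) * ι (not b)
  ι-not-∨ true  b = sym (zeroˡ _)
  ι-not-∨ false b = sym (*-identityˡ _)

  record BySign {A : Set} (xs : List A) (positive : A → Bool) (signingsOf : A → List A) : Set (c Level.⊔ ℓ) where
    field
      decompose : (f : A → Carrier) → Σ f xs ≈ Σ (λ a → ι (positive a) * Σ f (signingsOf a)) xs
  open BySign public

  bySign-singleton : {A : Set} {positive : A → Bool} {signingsOf : A → List A} (a : A) →
    positive a ≡ true → signingsOf a ≡ a ∷ [] → BySign (a ∷ []) positive signingsOf
  bySign-singleton a pos sgn .decompose f =
    +-cong (sym (trans (*-cong (reflexive (≡.cong ι pos)) (reflexive (≡.cong (Σ f) sgn)))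
                       (trans (*-identityˡ _) (+-identityʳ _))))
           refl

  bySign-⊗ : {A B C : Set} (g : A → B → C) {xs : List A} {ys : List B}
    {pa : A → Bool} {pb : B → Bool} {pc : C → Bool}
    {sa : A → List A} {sb : B → List B} {sc : C → List C} →
    BySign xs pa sa → BySign ys pb sb →
    (∀ a b → ι (pc (g a b)) ≈ ι (pa a) * ι (pb b)) →
    (∀ a b → sc (g a b) ≡ concatMap (λ a′ → map (g a′) (sb b)) (sa a)) →
    BySign (concatMap (λ a → map (g a) ys) xs) pc sc
  bySign-⊗ g {xs} {ys} {pa} {pb} {pc} {sa} {sb} {sc} A B pc≈ sc≡ .decompose f = begin
    Σ f (concatMap (λ a → map (g a) ys) xs)
      ≈⟨ Σ-concatMap-map f g xs ys ⟩
    Σ (λ a → Σ (λ b → f (g a b)) ys) xs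
      ≈⟨ decompose A _ ⟩
    Σ (λ a → ι (pa a) * Σ (λ a′ → Σ (λ b → f (g a′ b)) ys) (sa a)) xs
      ≈⟨ Σ-cong xs (λ a → *-cong refl (Σ-cong (sa a) (λ a′ → decompose B _))) ⟩
    Σ (λ a → ι (pa a) * Σ (λ a′ → Σ (λ b → ι (pb b) * Σ (λ b′ → f (g a′ b′)) (sb b)) ys) (sa a)) xs
      ≈⟨ Σ-cong xs (λ a → *-cong refl (Σ-swap _ (sa a) ys)) ⟩
    Σ (λ a → ι (pa a) * Σ (λ b → Σ (λ a′ → ι (pb b) * Σ (λ b′ → f (g a′ b′)) (sb b)) (sa a)) ys) xs
      ≈⟨ Σ-cong xs (λ a → trans (Σ-*ˡ _ _ ys) (Σ-cong ys (λ b → regroup a b))) ⟩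
    Σ (λ a → Σ (λ b → ι (pc (g a b)) * Σ f (sc (g a b))) ys) xs
      ≈⟨ sym (Σ-concatMap-map (λ z → ι (pc z) * Σ f (sc z)) g xs ys) ⟩
    Σ (λ z → ι (pc z) * Σ f (sc z)) (concatMap (λ a → map (g a) ys) xs) ∎
    where
    regroup : ∀ a b →
      ι (pa a) * Σ (λ a′ → ι (pb b) * Σ (λ b′ → f (g a′ b′)) (sb b)) (sa a)
        ≈ ι (pc (g a b)) * Σ f (sc (g a b))
    regroup a b = begin
      ι (pa a) * Σ (λ a′ → ι (pb b) * Σ (λ b′ → f (g a′ b′)) (sb b)) (sa a)
        ≈⟨ *-cong refl (sym (Σ-*ˡ _ _ (sa a))) ⟩
      ι (pa a) * (ι (pb b) * Σ (λ a′ → Σ (λ b′ → f (g a′ b′)) (sb b)) (sa a))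
        ≈⟨ sym (*-assoc _ _ _) ⟩
      (ι (pa a) * ι (pb b)) * Σ (λ a′ → Σ (λ b′ → f (g a′ b′)) (sb b)) (sa a)
        ≈⟨ *-cong (sym (pc≈ a b)) (sym (Σ-concatMap-map f g (sa a) (sb b))) ⟩
      ι (pc (g a b)) * Σ f (concatMap (λ a′ → map (g a′) (sb b)) (sa a))
        ≡⟨ ≡.cong (λ zs → ι (pc (g a b)) * Σ f zs) (≡.sym (sc≡ a b)) ⟩
      ι (pc (g a b)) * Σ f (sc (g a b)) ∎

  letters-bySign : (N : ℕ) → BySign (letters N) (λ l → not (neg l)) signs
  letters-bySign N .decompose f = begin
    Σ f (letters N)
      ≈⟨ Σ-concatMap f _ (upTo N) ⟩
    Σ (λ i → Σ f (signs (mkL (suc i) false))) (upTo N)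
      ≈⟨ Σ-cong (upTo N) (λ i → sym (trans (+-cong (*-identityˡ _) (trans (+-identityʳ _) (zeroˡ _))) (+-identityʳ _))) ⟩
    Σ (λ i → Σ (λ l → ι (not (neg l)) * Σ f (signs l)) (signs (mkL (suc i) false))) (upTo N)
      ≈⟨ sym (Σ-concatMap _ _ (upTo N)) ⟩
    Σ (λ l → ι (not (neg l)) * Σ f (signs l)) (letters N) ∎

  columns-bySign : (N h : ℕ) → BySign (columns N h) (λ c → not (any neg c)) columnSignings
  columns-bySign N zero    = bySign-singleton [] ≡.refl ≡.refl
  columns-bySign N (suc h) = bySign-⊗ (λ c l → l ∷ c) (columns-bySign N h) (letters-bySign N)
    (λ c l → trans (ι-not-∨ (neg l) (any neg c)) (*-comm _ _)) (λ _ _ → ≡.refl)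

  fillings-bySign : (N : ℕ) (la : List ℕ) → BySign (fillings N la) (λ τ → not (hasNeg τ)) signings
  fillings-bySign N []       = bySign-singleton [] ≡.refl ≡.refl
  fillings-bySign N (h ∷ la) = bySign-⊗ _∷_ (columns-bySign N h) (fillings-bySign N la)
    (λ c τ → ι-not-∨ (any neg c) (hasNeg τ)) (λ _ _ → ≡.refl)

  Π-upTo-suc : (f : ℕ → Carrier) (n : ℕ) → Π f (upTo (suc n)) ≈ f 0 * Π (λ r → f (suc r)) (upTo n)
  Π-upTo-suc f n = *-cong refl (reflexive (≡.trans (≡.cong (Π f) (≡.sym (map-upTo suc n))) (Π-map f suc (upTo n))))

  Π-dg-∷ : (h : ℕ) (la : List ℕ) (f : ℕ × ℕ → Carrier) →
    Π f (dg (h ∷ la)) ≈ Π (λ r → f (suc r , 0)) (upTo h) * Π (λ b → f (shiftRight b)) (dg la)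
  Π-dg-∷ h la f = begin
    Π f (dg (h ∷ la))                                    ≡⟨ ≡.cong (Π f) (dg-∷ h la) ⟩
    Π f (firstColumn h ++ map shiftRight (dg la))         ≈⟨ Π-++ f (firstColumn h) _ ⟩
    Π f (firstColumn h) * Π f (map shiftRight (dg la))    ≡⟨ ≡.cong₂ _*_ (Π-map f _ (upTo h)) (Π-map f shiftRight (dg la)) ⟩
    Π (λ r → f (suc r , 0)) (upTo h) * Π (λ b → f (shiftRight b)) (dg la) ∎

  Σ-columnSignings-Π : (c : List Letter) (G : ℕ → Bool → Carrier) →
    Σ (λ c′ → Π (λ r → G r (neg (nth (mkL 0 false) c′ r))) (upTo (length c))) (columnSignings c)
      ≈ Π (λ r → G r false + G r true) (upTo (length c))
  Σ-columnSignings-Π []      G = +-identityʳ _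
  Σ-columnSignings-Π (l ∷ c) G = begin
    Σ (λ c′ → Π (λ r → G r (neg (nth (mkL 0 false) c′ r))) (upTo (suc (length c)))) (columnSignings (l ∷ c))
      ≈⟨ Σ-⊗ _ (λ c′ l′ → l′ ∷ c′) _ (λ l′ → G 0 (neg l′)) (columnSignings c) (signs l)
             (λ c′ l′ → trans (Π-upTo-suc _ (length c)) (*-comm _ _)) ⟩
    Σ (λ c′ → Π (λ r → G (suc r) (neg (nth (mkL 0 false) c′ r))) (upTo (length c))) (columnSignings c)
      * (G 0 false + (G 0 true + 0#))
      ≈⟨ *-cong (Σ-columnSignings-Π c (λ r → G (suc r))) (+-cong refl (+-identityʳ _)) ⟩
    Π (λ r → G (suc r) false + G (suc r) true) (upTo (length c)) * (G 0 false + G 0 true)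
      ≈⟨ trans (*-comm _ _) (sym (Π-upTo-suc (λ r → G r false + G r true) (length c))) ⟩
    Π (λ r → G r false + G r true) (upTo (suc (length c))) ∎

  Σ-signings-Π : (la : List ℕ) (τ : Filling) → Shape la τ → (F : ℕ × ℕ → Bool → Carrier) →
    Σ (λ σ → Π (λ b → F b (signAt la σ b)) (dg la)) (signings τ) ≈ Π (λ b → F b false + F b true) (dg la)
  Σ-signings-Π []       []      []ˢ             F = +-identityʳ _
  Σ-signings-Π (h ∷ la) (c ∷ τ) (≡.refl ∷ˢ s) F = begin
    Σ (λ σ → Π (λ b → F b (signAt (h ∷ la) σ b)) (dg (h ∷ la))) (signings (c ∷ τ))
      ≈⟨ Σ-⊗ _ _∷_ _ _ (columnSignings c) (signings τ) (λ c′ σ → Π-dg-∷ h la _) ⟩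
    Σ (λ c′ → Π (λ r → F (suc r , 0) (neg (nth (mkL 0 false) c′ r))) (upTo h)) (columnSignings c)
      * Σ (λ σ → Π (λ b → F (shiftRight b) (signAt la σ b)) (dg la)) (signings τ)
      ≈⟨ *-cong (Σ-columnSignings-Π c (λ r → F (suc r , 0))) (Σ-signings-Π la τ s (λ b → F (shiftRight b))) ⟩
    Π (λ r → F (suc r , 0) false + F (suc r , 0) true) (upTo h) * Π (λ b → F (shiftRight b) false + F (shiftRight b) true) (dg la)
      ≈⟨ sym (Π-dg-∷ h la (λ b → F b false + F b true)) ⟩
    Π (λ b → F b false + F b true) (dg (h ∷ la)) ∎

-- The order on 𝒜 ∪ {0, ∞} under signing

rank-mono : (x y : ℕ) (s s′ : Bool) → x < y → rank (mkL x s) < rank (mkL y s′)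
rank-mono x y s s′ x<y = begin-strict
  2 ℕ.* x ℕ.+ sign s   ≤⟨ ℕₚ.+-monoʳ-≤ (2 ℕ.* x) (sign≤1 s) ⟩
  2 ℕ.* x ℕ.+ 1        ≡⟨ ℕₚ.+-comm (2 ℕ.* x) 1 ⟩
  suc (2 ℕ.* x)        <⟨ ℕₚ.n<1+n _ ⟩
  2 ℕ.+ 2 ℕ.* x        ≡⟨ ℕₚ.*-suc 2 x ⟨
  2 ℕ.* suc x          ≤⟨ ℕₚ.*-monoʳ-≤ 2 x<y ⟩
  2 ℕ.* y              ≤⟨ ℕₚ.m≤m+n _ _ ⟩
  2 ℕ.* y ℕ.+ sign s′  ∎
  where
  open ℕₚ.≤-Reasoning
  sign : Bool → ℕ
  sign s = if s then 1 else 0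
  sign≤1 : (s : Bool) → sign s ≤ 1
  sign≤1 true  = ℕₚ.≤-refl
  sign≤1 false = z≤n

rank-<ᵇ : (a b : Letter) → abs a ≢ abs b → (rank b <ᵇ rank a) ≡ (abs b <ᵇ abs a)
rank-<ᵇ (mkL x s) (mkL y s′) x≢y with ℕₚ.<-cmp x y
... | tri< x<y _ _ = ≡.trans (<ᵇ≡false (ℕₚ.<⇒≤ (rank-mono x y s s′ x<y))) (≡.sym (<ᵇ≡false (ℕₚ.<⇒≤ x<y)))
... | tri≈ _ x≡y _ = ⊥-elim (x≢y x≡y)
... | tri> _ _ y<x = ≡.trans (<ᵇ≡true (rank-mono y x s′ s y<x)) (≡.sym (<ᵇ≡true y<x))

I-apart : (a b : Letter) → abs a ≢ abs b → I (ltr a) (ltr b) ≡ (abs b <ᵇ abs a)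
I-apart a b |a|≢|b| rewrite rank-<ᵇ a b |a|≢|b| | ≡ᵇ≡false |a|≢|b| = ∨-identityʳ _

I-tie : (a b : Letter) → abs a ≡ abs b → I (ltr a) (ltr b) ≡ neg a
I-tie (mkL i false) (mkL .i false) ≡.refl rewrite <ᵇ≡false {2 ℕ.* i ℕ.+ 0} ℕₚ.≤-refl = ∧-zeroʳ _
I-tie (mkL i true)  (mkL .i true)  ≡.refl rewrite <ᵇ≡false {2 ℕ.* i ℕ.+ 1} ℕₚ.≤-refl | ≡ᵇ≡true {i} ≡.refl = ≡.refl
I-tie (mkL i true)  (mkL .i false) ≡.refl
  rewrite <ᵇ≡true {2 ℕ.* i ℕ.+ 0} {2 ℕ.* i ℕ.+ 1} (ℕₚ.+-monoʳ-< (2 ℕ.* i) (s≤s z≤n)) = ≡.refl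
I-tie (mkL i false) (mkL .i true)  ≡.refl
  rewrite <ᵇ≡false {2 ℕ.* i ℕ.+ 1} {2 ℕ.* i ℕ.+ 0} (ℕₚ.+-monoʳ-≤ (2 ℕ.* i) z≤n) = ∧-zeroʳ _

sameAbs : Ext → Ext → Bool
sameAbs (ltr a) (ltr b) = abs a ≡ᵇ abs b
sameAbs _       _       = false

sameAbs-sym : (X Y : Ext) → sameAbs X Y ≡ sameAbs Y X
sameAbs-sym (ltr a) (ltr b) = ≡ᵇ-sym (abs a) (abs b)
sameAbs-sym zeroE   zeroE   = ≡.refl
sameAbs-sym zeroE   (ltr _) = ≡.refl
sameAbs-sym zeroE   infE    = ≡.refl
sameAbs-sym (ltr _) zeroE   = ≡.refl
sameAbs-sym (ltr _) infE    = ≡.refl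
sameAbs-sym infE    zeroE   = ≡.refl
sameAbs-sym infE    (ltr _) = ≡.refl
sameAbs-sym infE    infE    = ≡.refl

sameAbs-∞ : (X : Ext) → sameAbs X infE ≡ false
sameAbs-∞ zeroE   = ≡.refl
sameAbs-∞ (ltr _) = ≡.refl
sameAbs-∞ infE    = ≡.refl

barredTie : Ext → Ext → Bool
barredTie (ltr a) (ltr b) = neg a ∧ (abs a ≡ᵇ abs b)
barredTie _       _       = false

-- X ≈± X′ : X′ is an entry of a positive τ̂ and X the entry in the same box of a σ̂ with |σ| = τ.
data _≈±_ : Ext → Ext → Set where
  0±   : zeroE ≈± zeroE
  ∞±   : infE ≈± infE
  ltr± : {a a′ : Letter} → abs a ≡ abs a′ → neg a′ ≡ false → ltr a ≈± ltr a′

I-signed : {X X′ Y Y′ : Ext} → X ≈± X′ → Y ≈± Y′ → sameAbs X′ Y′ ≡ false → I X Y ≡ I X′ Y′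
I-signed 0± 0± _ = ≡.refl
I-signed 0± ∞± _ = ≡.refl
I-signed 0± (ltr± _ _) _ = ≡.refl
I-signed ∞± 0± _ = ≡.refl
I-signed ∞± ∞± _ = ≡.refl
I-signed ∞± (ltr± _ _) _ = ≡.refl
I-signed (ltr± _ _) 0± _ = ≡.refl
I-signed (ltr± _ _) ∞± _ = ≡.refl
I-signed {ltr a} {ltr a′} {ltr b} {ltr b′} (ltr± a≡a′ _) (ltr± b≡b′ _) apart = begin
  I (ltr a) (ltr b)      ≡⟨ I-apart a b (λ a≡b → |a′|≢|b′| (≡.trans (≡.sym a≡a′) (≡.trans a≡b b≡b′))) ⟩
  (abs b <ᵇ abs a)       ≡⟨ ≡.cong₂ _<ᵇ_ b≡b′ a≡a′ ⟩
  (abs b′ <ᵇ abs a′)     ≡⟨ I-apart a′ b′ |a′|≢|b′| ⟨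
  I (ltr a′) (ltr b′)    ∎
  where
  open ≡.≡-Reasoning
  |a′|≢|b′| = ≡ᵇ≡false⇒≢ apart

barredTie-apart : {A A′ B B′ : Ext} → A ≈± A′ → B ≈± B′ → sameAbs A′ B′ ≡ false → barredTie A B ≡ false
barredTie-apart 0± _ _ = ≡.refl
barredTie-apart ∞± _ _ = ≡.refl
barredTie-apart (ltr± _ _) 0± _ = ≡.refl
barredTie-apart (ltr± _ _) ∞± _ = ≡.refl
barredTie-apart {ltr a} (ltr± a≡a′ _) (ltr± b≡b′ _) apart
  rewrite a≡a′ | b≡b′ | apart = ∧-zeroʳ _

I-flip : (a b : Letter) (C : Ext) → abs a ≡ abs b → isZeroE C ≡ false → sameAbs C (ltr b) ≡ false →
  I (ltr a) C ≡ not (I C (ltr b))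
I-flip a b infE    _       _ _     = ≡.refl
I-flip a b (ltr c) |a|≡|b| _ apart = begin
  I (ltr a) (ltr c)        ≡⟨ I-apart a c (λ a≡c → |c|≢|b| (≡.trans (≡.sym a≡c) |a|≡|b|)) ⟩
  (abs c <ᵇ abs a)         ≡⟨ ≡.cong (abs c <ᵇ_) |a|≡|b| ⟩
  (abs c <ᵇ abs b)         ≡⟨ <ᵇ-asym (abs c) (abs b) |c|≢|b| ⟩
  not (abs b <ᵇ abs c)     ≡⟨ ≡.cong not (I-apart c b |c|≢|b|) ⟨
  not (I (ltr c) (ltr b))  ∎
  where
  open ≡.≡-Reasoning
  |c|≢|b| = ≡ᵇ≡false⇒≢ apart

Qf-cong : (A B C : Ext) {u v w : Bool} → I A B ≡ u → I C B ≡ v → I A C ≡ w →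
  Qf A B C ≡ exactlyOne u (not v) (not w)
Qf-cong A B C ≡.refl ≡.refl ≡.refl = ≡.refl

exactlyOne-tie : (s X : Bool) →
  bool→ℕ (exactlyOne s (not X) (not (not X))) ℕ.+ bool→ℕ s ≡ bool→ℕ (exactlyOne false (not X) (not (not X)))
exactlyOne-tie true  true  = ≡.refl
exactlyOne-tie true  false = ≡.refl
exactlyOne-tie false true  = ≡.refl
exactlyOne-tie false false = ≡.refl

Qf-signed-apart : {A A′ B B′ C C′ : Ext} → A ≈± A′ → B ≈± B′ → C ≈± C′ →
  sameAbs C′ A′ ≡ false → sameAbs C′ B′ ≡ false → sameAbs A′ B′ ≡ false →
  bool→ℕ (Qf A B C) ℕ.+ bool→ℕ (barredTie A B) ≡ bool→ℕ (Qf A′ B′ C′)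
Qf-signed-apart {A} {A′} {B} {B′} {C} {C′} A± B± C± C′#A′ C′#B′ A′#B′ = begin
  bool→ℕ (Qf A B C) ℕ.+ bool→ℕ (barredTie A B)
    ≡⟨ ≡.cong (λ z → bool→ℕ (Qf A B C) ℕ.+ bool→ℕ z) (barredTie-apart A± B± A′#B′) ⟩
  bool→ℕ (Qf A B C) ℕ.+ 0
    ≡⟨ ℕₚ.+-identityʳ _ ⟩
  bool→ℕ (Qf A B C)
    ≡⟨ ≡.cong bool→ℕ (Qf-cong A B C (I-signed A± B± A′#B′) (I-signed C± B± C′#B′)
                                    (I-signed A± C± (≡.trans (sameAbs-sym A′ C′) C′#A′))) ⟩
  bool→ℕ (Qf A′ B′ C′) ∎
  where open ≡.≡-Reasoning

-- I(c, b) and I(a, c) are complementary, so 𝒬(a, b, c) = 1 − [a ∈ ℤ₋] while 𝒬(a′, b′, c′) = 1.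
Qf-signed-tie : {a a′ b b′ : Letter} {C C′ : Ext} → ltr a ≈± ltr a′ → ltr b ≈± ltr b′ → C ≈± C′ →
  isZeroE C′ ≡ false → sameAbs C′ (ltr a′) ≡ false → sameAbs C′ (ltr b′) ≡ false → abs a′ ≡ abs b′ →
  bool→ℕ (Qf (ltr a) (ltr b) C) ℕ.+ bool→ℕ (barredTie (ltr a) (ltr b)) ≡ bool→ℕ (Qf (ltr a′) (ltr b′) C′)
Qf-signed-tie {a} {a′} {b} {b′} {C} {C′} A±@(ltr± a≡a′ a′⁺) B±@(ltr± b≡b′ _) C± C′≢0 C′#a′ C′#b′ a′≡b′ = begin
  bool→ℕ (Qf (ltr a) (ltr b) C) ℕ.+ bool→ℕ (barredTie (ltr a) (ltr b))
    ≡⟨ ≡.cong₂ ℕ._+_ (≡.cong bool→ℕ (Qf-cong (ltr a) (ltr b) C (I-tie a b a≡b) (I-signed C± B± C′#b′) I[a,C]))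
                     (≡.cong (λ z → bool→ℕ (neg a ∧ z)) (≡ᵇ≡true a≡b)) ⟩
  bool→ℕ (exactlyOne (neg a) (not X) (not (not X))) ℕ.+ bool→ℕ (neg a ∧ true)
    ≡⟨ ≡.cong (λ z → bool→ℕ (exactlyOne (neg a) (not X) (not (not X))) ℕ.+ bool→ℕ z) (∧-identityʳ (neg a)) ⟩
  bool→ℕ (exactlyOne (neg a) (not X) (not (not X))) ℕ.+ bool→ℕ (neg a)
    ≡⟨ exactlyOne-tie (neg a) X ⟩
  bool→ℕ (exactlyOne false (not X) (not (not X)))
    ≡⟨ ≡.cong bool→ℕ (Qf-cong (ltr a′) (ltr b′) C′ (≡.trans (I-tie a′ b′ a′≡b′) a′⁺) ≡.refl I[a′,C′]) ⟨
  bool→ℕ (Qf (ltr a′) (ltr b′) C′) ∎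
  where
  open ≡.≡-Reasoning
  X = I C′ (ltr b′)
  a≡b = ≡.trans a≡a′ (≡.trans a′≡b′ (≡.sym b≡b′))
  I[a′,C′] : I (ltr a′) C′ ≡ not X
  I[a′,C′] = I-flip a′ b′ C′ a′≡b′ C′≢0 C′#b′
  I[a,C] : I (ltr a) C ≡ not X
  I[a,C] = ≡.trans (I-signed A± C± (≡.trans (sameAbs-sym (ltr a′) C′) C′#a′)) I[a′,C′]

Qf-signed : {A A′ B B′ C C′ : Ext} → A ≈± A′ → B ≈± B′ → C ≈± C′ → isZeroE C′ ≡ false →
  sameAbs C′ A′ ≡ false → sameAbs C′ B′ ≡ false →
  bool→ℕ (Qf A B C) ℕ.+ bool→ℕ (barredTie A B) ≡ bool→ℕ (Qf A′ B′ C′)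
Qf-signed {A′ = A′} {B′ = B′} A± B± C± C′≢0 C′#A′ C′#B′ with sameAbs A′ B′ in A′∼B′
... | false = Qf-signed-apart A± B± C± C′#A′ C′#B′ A′∼B′
Qf-signed A±@(ltr± _ _) B±@(ltr± _ _) C± C′≢0 C′#A′ C′#B′ | true =
  Qf-signed-tie A± B± C± C′≢0 C′#A′ C′#B′ (≡ᵇ≡true⇒≡ A′∼B′)

triple-absent : (g : Bool) {Q Q′ tie : Bool} {C C′ : Ext} → C ≈± C′ → isZeroE C′ ≡ true → tie ≡ false →
  bool→ℕ (g ∧ not (isZeroE C) ∧ Q) ℕ.+ bool→ℕ tie ≡ bool→ℕ (g ∧ not (isZeroE C′) ∧ Q′)
triple-absent g 0± _ ≡.refl rewrite ∧-zeroʳ g = ≡.refl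

triple-present : {A A′ B B′ C C′ : Ext} (g x : Bool) → A ≈± A′ → B ≈± B′ → C ≈± C′ → g ≡ true →
  isZeroE C′ ≡ false → sameAbs C′ A′ ≡ false → sameAbs C′ B′ ≡ false → (barredTie A B ∧ x) ≡ barredTie A B →
  bool→ℕ (g ∧ not (isZeroE C) ∧ Qf A B C) ℕ.+ bool→ℕ (barredTie A B ∧ x)
    ≡ bool→ℕ (g ∧ not (isZeroE C′) ∧ Qf A′ B′ C′)
triple-present g x A± B± ∞± ≡.refl C′≢0 C′#A′ C′#B′ tie
  rewrite tie = Qf-signed A± B± ∞± C′≢0 C′#A′ C′#B′
triple-present g x A± B± C±@(ltr± _ _) ≡.refl C′≢0 C′#A′ C′#B′ tie
  rewrite tie = Qf-signed A± B± C± C′≢0 C′#A′ C′#B′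

-- Non-attacking fillings

nonAttacking⇒attack-free : (la : List ℕ) (τ : Filling) → nonAttacking la τ ≡ true →
  ∀ {u v} → u ∈ dg la → v ∈ dg la → attacks la τ u v ≡ false
nonAttacking⇒attack-free la τ peace {u} u∈ v∈ =
  any≡false⇒∈ (attacks la τ u) (any≡false⇒∈ (λ u → any (attacks la τ u) (dg la))
    (≡.trans (≡.sym (not-involutive _)) (≡.cong not peace)) u∈) v∈

module AttackFree (la : List ℕ) (τ : Filling)
  (τ-attack-free : ∀ {u v} → u ∈ dg la → v ∈ dg la → attacks la τ u v ≡ false)
  where

  H : ℕ → ℕ
  H = nth 0 la

  attack-free : {i j i′ j′ : ℕ} → 1 ≤ i → i ≤ H j → 1 ≤ i′ → i′ ≤ H j′ →
    not ((i ≡ᵇ i′) ∧ (j ≡ᵇ j′)) ≡ true →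
    ((i ≡ᵇ i′) ∨ ((i ≡ᵇ i′ ℕ.+ 1) ∧ (j <ᵇ j′) ∧ (H j′ <ᵇ H j)) ∨ ((i ≡ᵇ i′ ℕ.+ 1) ∧ (j′ <ᵇ j) ∧ (H j ≡ᵇ H j′))) ≡ true →
    (abs (ent la τ i j) ≡ᵇ abs (ent la τ i′ j′)) ≡ false
  attack-free 1≤i i≤h 1≤i′ i′≤h′ distinct attackable =
    ∧-middle≡false (τ-attack-free (∈-dg la 1≤i i≤h) (∈-dg la 1≤i′ i′≤h′)) distinct attackable

  row-apart : {i j k : ℕ} → j ≢ k → 1 ≤ i → i ≤ H j → i ≤ H k →
    (abs (ent la τ i k) ≡ᵇ abs (ent la τ i j)) ≡ false
  row-apart {i} {j} {k} j≢k 1≤i i≤hj i≤hk = attack-free 1≤i i≤hk 1≤i i≤hj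
    (≡.cong not (≡.trans (≡.cong (_∧ (k ≡ᵇ j)) (≡ᵇ≡true {i} ≡.refl)) (≡ᵇ≡false (λ k≡j → j≢k (≡.sym k≡j)))))
    (∨-introˡ (≡ᵇ≡true {i} ≡.refl))

  ladder-apart : {r j k : ℕ} → j < k → H k < H j → 1 ≤ r → suc r ≤ H j → r ≤ H k →
    (abs (ent la τ (suc r) j) ≡ᵇ abs (ent la τ r k)) ≡ false
  ladder-apart {r} {j} {k} j<k hk<hj 1≤r r<hj r≤hk = attack-free (s≤s z≤n) r<hj 1≤r r≤hk
    (≡.cong (λ b → not (b ∧ (j ≡ᵇ k))) (≡ᵇ≡false (ℕₚ.1+n≢n {r})))
    (∨-introʳ {suc r ≡ᵇ r} (∨-introˡ (≡.trans (≡.cong (λ b → b ∧ (j <ᵇ k) ∧ (H k <ᵇ H j)) (≡ᵇ≡true (ℕₚ.+-comm 1 r)))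
                                      (≡.trans (≡.cong (_∧ (H k <ᵇ H j)) (<ᵇ≡true j<k)) (<ᵇ≡true hk<hj)))))

  rectangle-apart : {r j k : ℕ} → j < k → H k ≡ H j → 1 ≤ r → suc r ≤ H k → r ≤ H j →
    (abs (ent la τ (suc r) k) ≡ᵇ abs (ent la τ r j)) ≡ false
  rectangle-apart {r} {j} {k} j<k hk≡hj 1≤r r<hk r≤hj = attack-free (s≤s z≤n) r<hk 1≤r r≤hj
    (≡.cong (λ b → not (b ∧ (k ≡ᵇ j))) (≡ᵇ≡false (ℕₚ.1+n≢n {r})))
    (∨-introʳ {suc r ≡ᵇ r} (∨-introʳ (≡.trans (≡.cong (λ b → b ∧ (j <ᵇ k) ∧ (H k ≡ᵇ H j)) (≡ᵇ≡true (ℕₚ.+-comm 1 r)))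
                                      (≡.trans (≡.cong (_∧ (H k ≡ᵇ H j)) (<ᵇ≡true j<k)) (≡ᵇ≡true hk≡hj)))))

module _ (la : List ℕ) (σ τ : Filling) (|σ|≡τ : ∀ i j → abs (ent la σ i j) ≡ abs (ent la τ i j)) where

  attacks-abs : ∀ u v → attacks la σ u v ≡ attacks la τ u v
  attacks-abs (iu , ju) (iv , jv) = ≡.cong (λ same → not ((iu ≡ᵇ iv) ∧ (ju ≡ᵇ jv)) ∧ same ∧ ((iu ≡ᵇ iv)
      ∨ ((iu ≡ᵇ iv ℕ.+ 1) ∧ (ju <ᵇ jv) ∧ (ht la τ jv <ᵇ ht la τ ju))
      ∨ ((iu ≡ᵇ iv ℕ.+ 1) ∧ (jv <ᵇ ju) ∧ (ht la τ ju ≡ᵇ ht la τ jv))))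
    (≡.cong₂ _≡ᵇ_ (|σ|≡τ iu ju) (|σ|≡τ iv jv))

  nonAttacking-abs : nonAttacking la σ ≡ nonAttacking la τ
  nonAttacking-abs = ≡.cong (λ bs → not (or bs))
    (map-cong (λ u → ≡.cong or (map-cong (attacks-abs u) (dg la))) (dg la))

  inM2-abs : All (1 ≤_) la → nonAttacking la τ ≡ true → inM2 la σ ≡ inM2 la τ
  inM2-abs parts≥1 peace = ≡.cong (λ bs → not (or bs)) (map-cong-local (All.tabulate adjacent))
    where
    open AttackFree la τ (nonAttacking⇒attack-free la τ peace) using (H; row-apart)
    descent : Filling → ℕ → Bool
    descent ρ j = (H j ≡ᵇ H (suc j)) ∧ not (rank (ent la ρ 1 (suc j)) <ᵇ rank (ent la ρ 1 j))
    adjacent : ∀ {j} → j ∈ upTo (length la ∸ 1) → descent σ j ≡ descent τ j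
    adjacent {j} j∈ with H j ≡ᵇ H (suc j)
    ... | false = ≡.refl
    ... | true  = ≡.cong not (begin
      rank (ent la σ 1 (suc j)) <ᵇ rank (ent la σ 1 j)
        ≡⟨ rank-<ᵇ (ent la σ 1 j) (ent la σ 1 (suc j))
             (λ e → |τ₁|≢ (≡.trans (≡.sym (|σ|≡τ 1 (suc j))) (≡.trans (≡.sym e) (|σ|≡τ 1 j)))) ⟩
      abs (ent la σ 1 (suc j)) <ᵇ abs (ent la σ 1 j)
        ≡⟨ ≡.cong₂ _<ᵇ_ (|σ|≡τ 1 (suc j)) (|σ|≡τ 1 j) ⟩
      abs (ent la τ 1 (suc j)) <ᵇ abs (ent la τ 1 j)
        ≡⟨ rank-<ᵇ (ent la τ 1 j) (ent la τ 1 (suc j)) (λ e → |τ₁|≢ (≡.sym e)) ⟨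
      rank (ent la τ 1 (suc j)) <ᵇ rank (ent la τ 1 j) ∎)
      where
      open ≡.≡-Reasoning
      j+1<ℓ : suc j < length la
      j+1<ℓ with length la | ∈-upTo⁻ j∈
      ... | suc ℓ | j<ℓ = s≤s j<ℓ
      |τ₁|≢ : abs (ent la τ 1 (suc j)) ≢ abs (ent la τ 1 j)
      |τ₁|≢ = ≡ᵇ≡false⇒≢ (row-apart (λ j≡j+1 → ℕₚ.1+n≢n (≡.sym j≡j+1)) ℕₚ.≤-refl
                 (nth-All la parts≥1 (ℕₚ.<-trans (ℕₚ.n<1+n j) j+1<ℓ)) (nth-All la parts≥1 j+1<ℓ))

admissible : List ℕ → Filling → Bool
admissible la σ = inM2 la σ ∧ nonAttacking la σ

admissible-signing : (la : List ℕ) → All (1 ≤_) la → (τ : Filling) {σ : Filling} → σ ∈ signings τ →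
  admissible la σ ≡ admissible la τ
admissible-signing la parts≥1 τ {σ} σ∈ with nonAttacking la τ in peace
... | true  = ≡.cong₂ _∧_ (inM2-abs la σ τ |σ|≡τ parts≥1 peace) (≡.trans (nonAttacking-abs la σ τ |σ|≡τ) peace)
  where |σ|≡τ = signings-abs la τ σ∈
... | false = ≡.trans (≡.cong (inM2 la σ ∧_) (≡.trans (nonAttacking-abs la σ τ (signings-abs la τ σ∈)) peace))
                      (≡.trans (∧-zeroʳ (inM2 la σ)) (≡.sym (∧-zeroʳ (inM2 la τ))))

-- Statistics of a signing

equalsSouth : List ℕ → Filling → ℕ → ℕ → Bool
equalsSouth la τ i j = (1 <ᵇ i) ∧ (abs (ent la τ i j) ≡ᵇ abs (ent la τ (i ∸ 1) j))

majTerm : List ℕ → Filling → ℕ × ℕ → ℕ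
majTerm la ρ (i , j) = if (1 <ᵇ i) ∧ I (ltr (ent la ρ i j)) (ltr (ent la ρ (i ∸ 1) j)) then leg la ρ (i , j) ℕ.+ 1 else 0

module SignedFilling (la : List ℕ) (σ τ : Filling)
  (|σ|≡τ : ∀ i j → abs (ent la σ i j) ≡ abs (ent la τ i j))
  (τ⁺ : ∀ i j → neg (ent la τ i j) ≡ false)
  where

  H : ℕ → ℕ
  H = nth 0 la

  hat-signed : ∀ r j → hat la σ r j ≈± hat la τ r j
  hat-signed zero    j = ∞±
  hat-signed (suc r) j with suc r ≤ᵇ H j
  ... | true  = ltr± (|σ|≡τ (suc r) j) (τ⁺ (suc r) j)
  ... | false = 0±

  hat-inside : (ρ : Filling) {r j : ℕ} → suc r ≤ H j → hat la ρ (suc r) j ≡ ltr (ent la ρ (suc r) j)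
  hat-inside ρ r<h rewrite ≤ᵇ≡true r<h = ≡.refl

  hat-outside : (ρ : Filling) {r j : ℕ} → H j < suc r → hat la ρ (suc r) j ≡ zeroE
  hat-outside ρ h<r rewrite ≤ᵇ≡false h<r = ≡.refl

  majTerm-signed : ∀ i j → majTerm la σ (i , j)
    ≡ (if neg (ent la σ i j) ∧ equalsSouth la τ i j then leg la τ (i , j) ℕ.+ 1 else majTerm la τ (i , j))
  majTerm-signed i j with 1 <ᵇ i
  ... | false rewrite ∧-zeroʳ (neg (ent la σ i j)) = ≡.refl
  ... | true with abs (ent la τ i j) ℕ.≟ abs (ent la τ (i ∸ 1) j)
  ...   | yes same = begin
    (if I (ltr (ent la σ i j)) (ltr (ent la σ (i ∸ 1) j)) then ℓ+1 else 0)
      ≡⟨ ≡.cong (λ b → if b then ℓ+1 else 0) (I-tie (ent la σ i j) (ent la σ (i ∸ 1) j)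
           (≡.trans (|σ|≡τ i j) (≡.trans same (≡.sym (|σ|≡τ (i ∸ 1) j))))) ⟩
    (if neg (ent la σ i j) then ℓ+1 else 0)
      ≡⟨ ≡.cong₂ (λ b c → if b then ℓ+1 else (if c then ℓ+1 else 0))
           (≡.sym (≡.trans (≡.cong (neg (ent la σ i j) ∧_) (≡ᵇ≡true same)) (∧-identityʳ _)))
           (≡.sym (≡.trans (I-tie (ent la τ i j) (ent la τ (i ∸ 1) j) same) (τ⁺ i j))) ⟩
    (if neg (ent la σ i j) ∧ (abs (ent la τ i j) ≡ᵇ abs (ent la τ (i ∸ 1) j)) then ℓ+1
     else (if I (ltr (ent la τ i j)) (ltr (ent la τ (i ∸ 1) j)) then ℓ+1 else 0)) ∎
    where
    open ≡.≡-Reasoning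
    ℓ+1 = leg la τ (i , j) ℕ.+ 1
  ...   | no apart = begin
    (if I (ltr (ent la σ i j)) (ltr (ent la σ (i ∸ 1) j)) then ℓ+1 else 0)
      ≡⟨ ≡.cong (λ b → if b then ℓ+1 else 0) (≡.trans
           (I-apart (ent la σ i j) (ent la σ (i ∸ 1) j)
              (λ e → apart (≡.trans (≡.sym (|σ|≡τ i j)) (≡.trans e (|σ|≡τ (i ∸ 1) j)))))
           (≡.trans (≡.cong₂ _<ᵇ_ (|σ|≡τ (i ∸ 1) j) (|σ|≡τ i j))
                    (≡.sym (I-apart (ent la τ i j) (ent la τ (i ∸ 1) j) apart)))) ⟩
    (if I (ltr (ent la τ i j)) (ltr (ent la τ (i ∸ 1) j)) then ℓ+1 else 0)
      ≡⟨ ≡.cong (λ b → if b then ℓ+1 else (if I (ltr (ent la τ i j)) (ltr (ent la τ (i ∸ 1) j)) then ℓ+1 else 0))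
           (≡.sym (≡.trans (≡.cong (neg (ent la σ i j) ∧_) (≡ᵇ≡false apart)) (∧-zeroʳ _))) ⟩
    (if neg (ent la σ i j) ∧ (abs (ent la τ i j) ≡ᵇ abs (ent la τ (i ∸ 1) j)) then ℓ+1
     else (if I (ltr (ent la τ i j)) (ltr (ent la τ (i ∸ 1) j)) then ℓ+1 else 0)) ∎
    where
    open ≡.≡-Reasoning
    ℓ+1 = leg la τ (i , j) ℕ.+ 1

  module Mixinv
    (τ-attack-free : ∀ {u v} → u ∈ dg la → v ∈ dg la → attacks la τ u v ≡ false)
    (la-antitone : ∀ {j k} → j < k → nth 0 la k ≤ nth 0 la j)
    where
    open AttackFree la τ τ-attack-free hiding (H)

    -- A barred entry of σ̂ at (r+1, j) over an entry of equal absolute value removes exactly the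
    -- triple (j, k, r) for every k > j whose column reaches row r; all other triples agree with τ.
    tieAt : ℕ → ℕ → Bool
    tieAt j r = barredTie (hat la σ (suc r) j) (hat la σ r j)

    apart-below : ∀ {j k} r → j < k → H k ≡ H j → suc r ≤ H j →
      sameAbs (hat la τ (suc r) k) (hat la τ r j) ≡ false
    apart-below zero    j<k hk≡hj r<hj = sameAbs-∞ (hat la τ 1 _)
    apart-below (suc r) j<k hk≡hj r<hj =
      ≡.trans (≡.cong₂ sameAbs (hat-inside τ r<hk) (hat-inside τ (ℕₚ.<⇒≤ r<hj)))
              (rectangle-apart j<k hk≡hj (s≤s z≤n) r<hk (ℕₚ.<⇒≤ r<hj))
      where r<hk = ≡.subst (suc (suc r) ≤_) (≡.sym hk≡hj) r<hj

    triple-signed-sameHeight : ∀ {j k} r → j < k → H j ≡ H k →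
      bool→ℕ (triple la σ j k r) ℕ.+ bool→ℕ (tieAt j r ∧ (r ≤ᵇ H k)) ≡ bool→ℕ (triple la τ j k r)
    triple-signed-sameHeight {j} {k} r j<k hj≡hk rewrite ≡ᵇ≡true hj≡hk | ℕₚ.+-comm r 1 with suc r ℕₚ.≤? H j
    ... | no r≮hj = triple-absent (suc r ≤ᵇ H k ℕ.+ 1) (hat-signed (suc r) k)
          (≡.cong isZeroE (hat-outside τ (≡.subst (_< suc r) hj≡hk (ℕₚ.≰⇒> r≮hj))))
          (≡.cong (λ A → barredTie A (hat la σ r j) ∧ (r ≤ᵇ H k)) (hat-outside σ (ℕₚ.≰⇒> r≮hj)))
    ... | yes r<hj = triple-present _ _ (hat-signed (suc r) j) (hat-signed r j) (hat-signed (suc r) k)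
          (≤ᵇ≡true (ℕₚ.≤-trans r<hk (ℕₚ.m≤m+n _ 1)))
          (≡.cong isZeroE (hat-inside τ r<hk))
          (≡.trans (≡.cong₂ sameAbs (hat-inside τ r<hk) (hat-inside τ r<hj)) (row-apart (ℕₚ.<⇒≢ j<k) (s≤s z≤n) r<hj r<hk))
          (apart-below r j<k (≡.sym hj≡hk) r<hj)
          (≡.trans (≡.cong (tieAt j r ∧_) (≤ᵇ≡true (ℕₚ.≤-trans (ℕₚ.n≤1+n r) r<hk))) (∧-identityʳ _))
      where r<hk = ≡.subst (suc r ≤_) hj≡hk r<hj

    triple-signed-shorter : ∀ {j k} r → j < k → H k < H j → r ≤ H j →
      bool→ℕ (triple la σ j k r) ℕ.+ bool→ℕ (tieAt j r ∧ (r ≤ᵇ H k)) ≡ bool→ℕ (triple la τ j k r)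
    triple-signed-shorter {j} {k} zero j<k hk<hj _ rewrite ≡ᵇ≡false (ℕₚ.>⇒≢ hk<hj) =
      triple-present _ _ (hat-signed 1 j) (hat-signed 0 j) ∞± ≡.refl ≡.refl ≡.refl ≡.refl
        (∧-identityʳ _)
    triple-signed-shorter {j} {k} (suc r) j<k hk<hj r<hj rewrite ≡ᵇ≡false (ℕₚ.>⇒≢ hk<hj) | ℕₚ.+-comm r 1
      with suc r ℕₚ.≤? H k
    ... | no r≮hk = triple-absent (suc r ≤ᵇ H k ℕ.+ 1) (hat-signed (suc r) k) (≡.cong isZeroE (hat-outside τ (ℕₚ.≰⇒> r≮hk)))
          (≡.trans (≡.cong (tieAt j (suc r) ∧_) (≤ᵇ≡false (ℕₚ.≰⇒> r≮hk))) (∧-zeroʳ _))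
    ... | yes r<hk = triple-present _ _ (hat-signed (suc (suc r)) j) (hat-signed (suc r) j) (hat-signed (suc r) k)
          (≤ᵇ≡true (ℕₚ.≤-trans r<hk (ℕₚ.m≤m+n _ 1)))
          (≡.cong isZeroE (hat-inside τ r<hk))
          (≡.trans (≡.cong₂ sameAbs (hat-inside τ r<hk) ≡.refl) apart-above)
          (≡.trans (≡.cong₂ sameAbs (hat-inside τ r<hk) (hat-inside τ r<hj)) (row-apart (ℕₚ.<⇒≢ j<k) (s≤s z≤n) r<hj r<hk))
          (≡.trans (≡.cong (tieAt j (suc r) ∧_) (≤ᵇ≡true r<hk)) (∧-identityʳ _))
      where
      apart-above : sameAbs (ltr (ent la τ (suc r) k)) (hat la τ (suc (suc r)) j) ≡ false
      apart-above with suc (suc r) ℕₚ.≤? H j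
      ... | no r+1≮hj rewrite hat-outside τ (ℕₚ.≰⇒> r+1≮hj) = ≡.refl
      ... | yes r+1<hj rewrite hat-inside τ r+1<hj =
        ≡.trans (≡ᵇ-sym (abs (ent la τ (suc r) k)) (abs (ent la τ (suc (suc r)) j)))
                (ladder-apart j<k hk<hj (s≤s z≤n) r+1<hj r<hk)

    triple-signed : ∀ {j k r} → j < k → r ≤ H j →
      bool→ℕ (triple la σ j k r) ℕ.+ bool→ℕ (tieAt j r ∧ (r ≤ᵇ H k)) ≡ bool→ℕ (triple la τ j k r)
    triple-signed {j} {k} {r} j<k r≤hj with H j ℕₚ.≟ H k
    ... | yes hj≡hk = triple-signed-sameHeight r j<k hj≡hk
    ... | no hj≢hk  = triple-signed-shorter r j<k (ℕₚ.≤∧≢⇒< (la-antitone j<k) (λ hk≡hj → hj≢hk (≡.sym hk≡hj))) r≤hj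

    open ℕSum

    L : ℕ
    L = length la

    rows₀ : ℕ → List ℕ
    rows₀ j = upTo (H j ℕ.+ 1)

    mixinv-as-∑ : (ρ : Filling) →
      mixinv la ρ ≡ ∑ (λ k → ∑ (λ j → ∑ (λ r → bool→ℕ (triple la ρ j k r)) (rows₀ j)) (upTo k)) (upTo L)
    mixinv-as-∑ ρ = ≡.trans (sum-map _ (colPairs la ρ)) (≡.trans (Σ-concatMap _ _ (upTo L))
      (Σ-cong (upTo L) (λ k → ≡.trans (Σ-map _ _ (upTo k)) (Σ-cong (upTo k) (λ j → count≡∑ (triple la ρ j k) (rows₀ j))))))

    tieTriples : ℕ
    tieTriples = ∑ (λ k → ∑ (λ j → ∑ (λ r → bool→ℕ (tieAt j r ∧ (r ≤ᵇ H k))) (rows₀ j)) (upTo k)) (upTo L)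

    mixinv-σ+tieTriples : mixinv la σ ℕ.+ tieTriples ≡ mixinv la τ
    mixinv-σ+tieTriples = begin
      mixinv la σ ℕ.+ tieTriples
        ≡⟨ ≡.cong (ℕ._+ tieTriples) (mixinv-as-∑ σ) ⟩
      ∑ (λ k → ∑ (λ j → ∑ (inv σ j k) (rows₀ j)) (upTo k)) (upTo L) ℕ.+ tieTriples
        ≡⟨ Σ-+ _ _ (upTo L) ⟨
      ∑ (λ k → ∑ (λ j → ∑ (inv σ j k) (rows₀ j)) (upTo k) ℕ.+ ∑ (λ j → ∑ (tie j k) (rows₀ j)) (upTo k)) (upTo L)
        ≡⟨ Σ-cong (upTo L) (λ k → ≡.trans (≡.sym (Σ-+ _ _ (upTo k))) (Σ-cong∈ (upTo k) (λ j j∈ → per-pair (∈-upTo⁻ j∈)))) ⟩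
      ∑ (λ k → ∑ (λ j → ∑ (inv τ j k) (rows₀ j)) (upTo k)) (upTo L)
        ≡⟨ mixinv-as-∑ τ ⟨
      mixinv la τ ∎
      where
      open ≡.≡-Reasoning
      inv : Filling → ℕ → ℕ → ℕ → ℕ
      inv ρ j k r = bool→ℕ (triple la ρ j k r)
      tie : ℕ → ℕ → ℕ → ℕ
      tie j k r = bool→ℕ (tieAt j r ∧ (r ≤ᵇ H k))
      per-pair : ∀ {j k} → j < k → ∑ (inv σ j k) (rows₀ j) ℕ.+ ∑ (tie j k) (rows₀ j) ≡ ∑ (inv τ j k) (rows₀ j)
      per-pair {j} j<k = ≡.trans (≡.sym (Σ-+ _ _ (rows₀ j)))
        (Σ-cong∈ (rows₀ j) (λ r r∈ → triple-signed j<k (ℕₚ.≤-pred (≡.subst (r <_) (ℕₚ.+-comm (H j) 1) (∈-upTo⁻ r∈)))))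

    -- the t-exponent lost by σ at a barred box equal to its South neighbour
    tieWeight : ℕ × ℕ → ℕ
    tieWeight (i , j) = if neg (ent la σ i j) ∧ equalsSouth la τ i j then arm la τ (i ∸ 1 , j) else 0

    tieWeight-column : ∀ j → ∑ (λ r → bool→ℕ (tieAt j r) ℕ.* arm la τ (r , j)) (rows₀ j)
                           ≡ ∑ (λ r → tieWeight (suc r , j)) (upTo (H j))
    tieWeight-column j = begin
      ∑ f (rows₀ j)                                      ≡⟨ ≡.cong (λ n → ∑ f (upTo n)) (ℕₚ.+-comm (H j) 1) ⟩
      ∑ f (upTo (suc (H j)))                         ≡⟨ ∑-upTo-suc f (H j) ⟩
      ∑ f (upTo (H j)) ℕ.+ f (H j)                   ≡⟨ ≡.cong₂ ℕ._+_ (Σ-cong∈ (upTo (H j)) (λ r r∈ → inside r (∈-upTo⁻ r∈))) top ⟩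
      ∑ (λ r → tieWeight (suc r , j)) (upTo (H j)) ℕ.+ 0 ≡⟨ ℕₚ.+-identityʳ _ ⟩
      ∑ (λ r → tieWeight (suc r , j)) (upTo (H j)) ∎
      where
      open ≡.≡-Reasoning
      f : ℕ → ℕ
      f r = bool→ℕ (tieAt j r) ℕ.* arm la τ (r , j)
      top : f (H j) ≡ 0
      top rewrite hat-outside σ {H j} {j} ℕₚ.≤-refl = ≡.refl
      bool→ℕ-* : (b : Bool) (n : ℕ) → bool→ℕ b ℕ.* n ≡ (if b then n else 0)
      bool→ℕ-* true  n = ℕₚ.+-identityʳ n
      bool→ℕ-* false n = ≡.refl
      inside : ∀ r → r < H j → f r ≡ tieWeight (suc r , j)
      inside r r<hj rewrite hat-inside σ r<hj with r
      ... | zero = ≡.cong (λ b → if b then arm la τ (0 , j) else 0) (≡.sym (∧-zeroʳ (neg (ent la σ 1 j))))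
      ... | suc r′ rewrite hat-inside σ (ℕₚ.<⇒≤ r<hj) =
        ≡.trans (bool→ℕ-* _ (arm la τ (suc r′ , j)))
          (≡.cong (λ b → if neg (ent la σ (suc (suc r′)) j) ∧ b then arm la τ (suc r′ , j) else 0)
                  (≡.cong₂ _≡ᵇ_ (|σ|≡τ (suc (suc r′)) j) (|σ|≡τ (suc r′) j)))

    tieTriples≡∑tieWeight : tieTriples ≡ ∑ tieWeight (dg la)
    tieTriples≡∑tieWeight = begin
      tieTriples
        ≡⟨ Σ-cong∈ (upTo L) (λ k k∈ → ≡.sym (∑-upTo-<ᵇ (λ j → Y j k) (ℕₚ.<⇒≤ (∈-upTo⁻ k∈)))) ⟩
      ∑ (λ k → ∑ (λ j → bool→ℕ (j <ᵇ k) ℕ.* Y j k) (upTo L)) (upTo L)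
        ≡⟨ Σ-swap _ (upTo L) (upTo L) ⟩
      ∑ (λ j → ∑ (λ k → bool→ℕ (j <ᵇ k) ℕ.* Y j k) (upTo L)) (upTo L)
        ≡⟨ Σ-cong (upTo L) (λ j → Σ-cong (upTo L) (λ k → Σ-*ˡ (bool→ℕ (j <ᵇ k)) (tie j k) (rows₀ j))) ⟩
      ∑ (λ j → ∑ (λ k → ∑ (λ r → bool→ℕ (j <ᵇ k) ℕ.* tie j k r) (rows₀ j)) (upTo L)) (upTo L)
        ≡⟨ Σ-cong (upTo L) (λ j → Σ-swap _ (upTo L) (rows₀ j)) ⟩
      ∑ (λ j → ∑ (λ r → ∑ (λ k → bool→ℕ (j <ᵇ k) ℕ.* tie j k r) (upTo L)) (rows₀ j)) (upTo L)
        ≡⟨ Σ-cong (upTo L) (λ j → Σ-cong (rows₀ j) (λ r → arm-count j r)) ⟩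
      ∑ (λ j → ∑ (λ r → bool→ℕ (tieAt j r) ℕ.* arm la τ (r , j)) (rows₀ j)) (upTo L)
        ≡⟨ Σ-cong (upTo L) tieWeight-column ⟩
      ∑ (λ j → ∑ (λ r → tieWeight (suc r , j)) (upTo (H j))) (upTo L)
        ≡⟨ Σ-cong (upTo L) (λ j → ≡.trans (≡.sym (Σ-map (λ i → tieWeight (i , j)) suc (upTo (H j))))
                                           (≡.sym (Σ-map tieWeight (λ i → (i , j)) (rows (H j))))) ⟩
      ∑ (λ j → ∑ tieWeight (map (λ i → (i , j)) (rows (H j)))) (upTo L)
        ≡⟨ Σ-concatMap tieWeight _ (upTo L) ⟨
      ∑ tieWeight (dg la) ∎
      where
      open ≡.≡-Reasoning
      tie : ℕ → ℕ → ℕ → ℕ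
      tie j k r = bool→ℕ (tieAt j r ∧ (r ≤ᵇ H k))
      Y : ℕ → ℕ → ℕ
      Y j k = ∑ (tie j k) (rows₀ j)
      swap-guards : (a d c : Bool) → bool→ℕ a ℕ.* bool→ℕ (d ∧ c) ≡ bool→ℕ d ℕ.* bool→ℕ (a ∧ c)
      swap-guards true  true  c = ≡.refl
      swap-guards true  false c = ≡.refl
      swap-guards false true  c = ≡.refl
      swap-guards false false c = ≡.refl
      arm-count : ∀ j r → ∑ (λ k → bool→ℕ (j <ᵇ k) ℕ.* tie j k r) (upTo L) ≡ bool→ℕ (tieAt j r) ℕ.* arm la τ (r , j)
      arm-count j r = begin
        ∑ (λ k → bool→ℕ (j <ᵇ k) ℕ.* tie j k r) (upTo L)
          ≡⟨ Σ-cong (upTo L) (λ k → swap-guards (j <ᵇ k) (tieAt j r) (r ≤ᵇ H k)) ⟩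
        ∑ (λ k → bool→ℕ (tieAt j r) ℕ.* bool→ℕ ((j <ᵇ k) ∧ (r ≤ᵇ H k))) (upTo L)
          ≡⟨ Σ-*ˡ (bool→ℕ (tieAt j r)) _ (upTo L) ⟨
        bool→ℕ (tieAt j r) ℕ.* ∑ (λ k → bool→ℕ ((j <ᵇ k) ∧ (r ≤ᵇ H k))) (upTo L)
          ≡⟨ ≡.cong (bool→ℕ (tieAt j r) ℕ.*_) (count≡∑ _ (upTo L)) ⟨
        bool→ℕ (tieAt j r) ℕ.* arm la τ (r , j) ∎

    mixinv-signed : mixinv la σ ℕ.+ ∑ tieWeight (dg la) ≡ mixinv la τ
    mixinv-signed = ≡.trans (≡.cong (mixinv la σ ℕ.+_) (≡.sym tieTriples≡∑tieWeight)) mixinv-σ+tieTriples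

-- Expansion of the sum over the signings of a positive filling

eqL-positive : (a b : Letter) → neg a ≡ false → neg b ≡ false → eqL a b ≡ (abs a ≡ᵇ abs b)
eqL-positive (mkL i false) (mkL j false) ≡.refl ≡.refl = ∧-identityʳ _

module SigningExpansion {c ℓ} (R : CommutativeRing c ℓ) (q t tinv : CommutativeRing.Carrier R)
  (t*tinv≈1 : CommutativeRing._≈_ R (CommutativeRing._*_ R t tinv) (CommutativeRing.1# R))
  (x : ℕ → CommutativeRing.Carrier R) (N n : ℕ) (la : List ℕ) (τ : Filling)
  (shape : Shape la τ) (τ-positive : hasNeg τ ≡ false) (τ-nonAttacking : nonAttacking la τ ≡ true)
  (la-antitone : ∀ {j k} → j < k → nth 0 la k ≤ nth 0 la j) (Σla≡n : sum la ≡ n)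
  where
  open CommutativeRing R
  open Gen R
  open ListSum commutativeSemiring hiding (∑)
  open Powers R
  open SumOverSignings R using (Σ-signings-Π)
  open import Relation.Binary.Reasoning.Setoid setoid
  open import Algebra.Solver.CommutativeMonoid *-commutativeMonoid using (solve; _⊜_; _⊕_)
  open import Algebra.Properties.Ring ring using (-1*x≈-x; -‿distribʳ-*)

  τ⁺ : ∀ i j → neg (ent la τ i j) ≡ false
  τ⁺ = hasNeg≡false⇒nonNeg la τ τ-positive

  τ-attack-free : ∀ {u v} → u ∈ dg la → v ∈ dg la → attacks la τ u v ≡ false
  τ-attack-free = nonAttacking⇒attack-free la τ τ-nonAttacking

  -- the factor of box b in the summand of a signing with sign s at b, up to the common factor K
  boxWeight : ℕ × ℕ → Bool → Carrier
  boxWeight (i , j) s =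
    (if s then - 1# else 1#) * ((if s then t else 1#) *
    (pow t (if s ∧ equalsSouth la τ i j then arm la τ (i ∸ 1 , j) else 0) *
     pow q (if s ∧ equalsSouth la τ i j then leg la τ (i , j) ℕ.+ 1 else majTerm la τ (i , j))))

  tinv^mix x^τ K : Carrier
  tinv^mix = pow tinv (mixinv la τ)
  x^τ = xw q t tinv x N n la τ
  K = tinv^mix * x^τ

  lhsTerm-signing : {σ : Filling} → σ ∈ signings τ →
    lhsTerm q t tinv x N n la σ ≈ K * Π (λ b → boxWeight b (signAt la σ b)) (dg la)
  lhsTerm-signing {σ} σ∈ = begin
    lhsTerm q t tinv x N n la σ
      ≈⟨ *-cong (*-cong (*-cong signs≈ (trans t-power t-split)) q-maj≈) x≈ ⟩
    ((Π-sign * ((Π-t * Π-tie) * tinv^mix)) * Π-q) * x^τ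
      ≈⟨ solve 6 (λ a b c d e f → ((a ⊕ ((b ⊕ c) ⊕ d)) ⊕ e) ⊕ f ⊜ (d ⊕ f) ⊕ (a ⊕ (b ⊕ (c ⊕ e)))) refl
               Π-sign Π-t Π-tie tinv^mix Π-q x^τ ⟩
    K * (Π-sign * (Π-t * (Π-tie * Π-q)))
      ≈⟨ *-cong refl (sym (trans (Π-* _ _ (dg la))
                          (*-cong refl (trans (Π-* _ _ (dg la)) (*-cong refl (Π-* _ _ (dg la))))))) ⟩
    K * Π (λ b → boxWeight b (signAt la σ b)) (dg la) ∎
    where
    open SignedFilling la σ τ (signings-abs la τ σ∈) τ⁺
    open Mixinv τ-attack-free la-antitone using (tieWeight; mixinv-signed)
    s : ℕ × ℕ → Bool
    s = signAt la σ
    W : ℕ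
    W = ℕSum.∑ tieWeight (dg la)
    Π-sign Π-t Π-tie Π-q : Carrier
    Π-sign = Π (λ b → if s b then - 1# else 1#) (dg la)
    Π-t = Π (λ b → if s b then t else 1#) (dg la)
    Π-tie = Π (λ b → pow t (tieWeight b)) (dg la)
    Π-q = Π (λ b → pow q (if s b ∧ equalsSouth la τ (proj₁ b) (proj₂ b) then leg la τ b ℕ.+ 1 else majTerm la τ b)) (dg la)

    signs≈ : pow (- 1#) (mStat la σ) ≈ Π-sign
    signs≈ = pow-count (- 1#) _ (dg la)

    n≡p+m : n ≡ pStat la σ ℕ.+ mStat la σ
    n≡p+m = ≡.trans (≡.sym Σla≡n) (≡.trans (≡.sym (length-dg la)) (≡.sym (ℕSum.count-not+count s (dg la))))

    t-power : powZ t tinv ((+ n ℤ.- + pStat la σ) ℤ.- + mixinv la σ) ≈ pow t (mStat la σ) * pow tinv (mixinv la σ)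
    t-power = trans (reflexive (≡.cong (λ m → powZ t tinv ((+ m ℤ.- + pStat la σ) ℤ.- + mixinv la σ)) n≡p+m))
                   (powZ-[p+m]-p-k t tinv t*tinv≈1 (pStat la σ) (mStat la σ) (mixinv la σ))

    t-split : pow t (mStat la σ) * pow tinv (mixinv la σ) ≈ (Π-t * Π-tie) * tinv^mix
    t-split = begin
      pow t m * pow tinv μ                           ≈⟨ *-identityʳ _ ⟨
      (pow t m * pow tinv μ) * 1#                    ≈⟨ *-cong refl (sym (pow-inverse t tinv t*tinv≈1 W)) ⟩
      (pow t m * pow tinv μ) * (pow t W * pow tinv W) ≈⟨ interchange _ _ _ _ ⟩
      (pow t m * pow t W) * (pow tinv μ * pow tinv W) ≈⟨ *-cong (*-cong (pow-count t _ (dg la)) t^W≈) (sym (pow-+ tinv μ W)) ⟩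
      (Π-t * Π-tie) * pow tinv (μ ℕ.+ W)             ≡⟨ ≡.cong (λ k → (Π-t * Π-tie) * pow tinv k) mixinv-signed ⟩
      (Π-t * Π-tie) * tinv^mix                       ∎
      where
      open import Algebra.Properties.CommutativeSemigroup *-commutativeSemigroup using (interchange)
      m = mStat la σ
      μ = mixinv la σ
      t^W≈ : pow t W ≈ Π-tie
      t^W≈ = trans (reflexive (≡.cong (pow t) (≡.sym (ℕSum.sum-map tieWeight (dg la))))) (pow-sum t tieWeight (dg la))

    q-maj≈ : pow q (maj la σ) ≈ Π-q
    q-maj≈ = trans (pow-sum q (majTerm la σ) (dg la))
                   (Π-cong (dg la) (λ b → reflexive (≡.cong (pow q) (majTerm-signed (proj₁ b) (proj₂ b)))))

    x≈ : xw q t tinv x N n la σ ≈ x^τ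
    x≈ = Π-cong (dg la) (λ b → reflexive (≡.cong x (signings-abs la τ σ∈ (proj₁ b) (proj₂ b))))

  boxFactor-positive : ∀ i j → boxFactor q t tinv x N n la τ (i , j)
    ≡ (if equalsSouth la τ i j then 1# - pow q (leg la τ (i , j) ℕ.+ 1) * pow t (1 ℕ.+ arm la τ (i ∸ 1 , j))
       else 1# - t)
  boxFactor-positive i j = ≡.cong (λ e → if (1 <ᵇ i) ∧ e then 1# - pow q (leg la τ (i , j) ℕ.+ 1) * pow t (1 ℕ.+ arm la τ (i ∸ 1 , j))
                                          else 1# - t)
    (eqL-positive (ent la τ i j) (ent la τ (i ∸ 1) j) (τ⁺ i j) (τ⁺ (i ∸ 1) j))

  majTerm-equalsSouth : ∀ i j → equalsSouth la τ i j ≡ true → majTerm la τ (i , j) ≡ 0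
  majTerm-equalsSouth i j tied with ∧≡true {1 <ᵇ i} tied
  ... | 1<i , same rewrite 1<i | I-tie (ent la τ i j) (ent la τ (i ∸ 1) j) (≡ᵇ≡true⇒≡ same) | τ⁺ i j = ≡.refl

  boxWeight-sum : ∀ b → boxWeight b false + boxWeight b true ≈ pow q (majTerm la τ b) * boxFactor q t tinv x N n la τ b
  boxWeight-sum (i , j) rewrite boxFactor-positive i j with equalsSouth la τ i j in tied
  ... | true rewrite majTerm-equalsSouth i j tied = begin
    1# * (1# * (1# * 1#)) + (- 1#) * (t * (pow t a * pow q ℓ+1))
      ≈⟨ +-cong (trans (*-identityˡ _) (trans (*-identityˡ _) (*-identityˡ _))) (-1*x≈-x _) ⟩
    1# + - (t * (pow t a * pow q ℓ+1))
      ≈⟨ +-cong refl (-‿cong (solve 3 (λ x y z → x ⊕ (y ⊕ z) ⊜ z ⊕ (x ⊕ y)) refl t (pow t a) (pow q ℓ+1))) ⟩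
    1# + - (pow q ℓ+1 * (t * pow t a))
      ≈⟨ *-identityˡ _ ⟨
    1# * (1# - pow q ℓ+1 * pow t (1 ℕ.+ a)) ∎
    where
    a = arm la τ (i ∸ 1 , j)
    ℓ+1 = leg la τ (i , j) ℕ.+ 1
  ... | false = begin
    1# * (1# * (1# * pow q m)) + (- 1#) * (t * (1# * pow q m))
      ≈⟨ +-cong (trans (*-identityˡ _) (trans (*-identityˡ _) (*-identityˡ _)))
                (trans (-1*x≈-x _) (-‿cong (trans (*-cong refl (*-identityˡ _)) (*-comm _ _)))) ⟩
    pow q m + - (pow q m * t)    ≈⟨ +-cong (sym (*-identityʳ _)) (-‿distribʳ-* _ _) ⟩
    pow q m * 1# + pow q m * - t  ≈⟨ distribˡ _ _ _ ⟨
    pow q m * (1# - t)            ∎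
    where m = majTerm la τ (i , j)

  rhsTerm-expansion : rhsTerm q t tinv x N n la τ ≈ K * Π (λ b → boxWeight b false + boxWeight b true) (dg la)
  rhsTerm-expansion = begin
    rhsTerm q t tinv x N n la τ
      ≈⟨ *-cong (*-cong (*-cong (pow-sum q (majTerm la τ) (dg la))
                                (reflexive (powZ-neg t tinv t*tinv≈1 (mixinv la τ)))) refl) refl ⟩
    ((Π-q * tinv^mix) * x^τ) * Π-factor
      ≈⟨ solve 4 (λ a b c d → ((a ⊕ b) ⊕ c) ⊕ d ⊜ (b ⊕ c) ⊕ (a ⊕ d)) refl Π-q tinv^mix x^τ Π-factor ⟩
    K * (Π-q * Π-factor)
      ≈⟨ *-cong refl (trans (sym (Π-* _ _ (dg la))) (Π-cong (dg la) (λ b → sym (boxWeight-sum b)))) ⟩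
    K * Π (λ b → boxWeight b false + boxWeight b true) (dg la) ∎
    where
    Π-q = Π (λ b → pow q (majTerm la τ b)) (dg la)
    Π-factor = Π (boxFactor q t tinv x N n la τ) (dg la)

  Σ-signings-lhsTerm : Σ (lhsTerm q t tinv x N n la) (signings τ) ≈ rhsTerm q t tinv x N n la τ
  Σ-signings-lhsTerm = begin
    Σ (lhsTerm q t tinv x N n la) (signings τ)
      ≈⟨ Σ-cong∈ (signings τ) (λ σ σ∈ → lhsTerm-signing σ∈) ⟩
    Σ (λ σ → K * Π (λ b → boxWeight b (signAt la σ b)) (dg la)) (signings τ)
      ≈⟨ sym (Σ-*ˡ K _ (signings τ)) ⟩
    K * Σ (λ σ → Π (λ b → boxWeight b (signAt la σ b)) (dg la)) (signings τ)
      ≈⟨ *-cong refl (Σ-signings-Π la τ shape boxWeight) ⟩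
    K * Π (λ b → boxWeight b false + boxWeight b true) (dg la)
      ≈⟨ sym rhsTerm-expansion ⟩
    rhsTerm q t tinv x N n la τ ∎

module _ {c ℓ} (R : CommutativeRing c ℓ) (q t tinv : CommutativeRing.Carrier R)
  (t*tinv≈1 : CommutativeRing._≈_ R (CommutativeRing._*_ R t tinv) (CommutativeRing.1# R))
  (x : ℕ → CommutativeRing.Carrier R) (N n : ℕ) (la : List ℕ)
  (parts≥1 : All (1 ≤_) la) (la-antitone : ∀ {j k} → j < k → nth 0 la k ≤ nth 0 la j) (Σla≡n : sum la ≡ n)
  where
  open CommutativeRing R
  open Gen R
  open ListSum commutativeSemiring hiding (∑)
  open import Relation.Binary.Reasoning.Setoid setoid

  Σ-signings-admissible : {τ : Filling} → τ ∈ fillings N la →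
    ι (not (hasNeg τ)) * Σ (λ σ → ι (admissible la σ) * lhsTerm q t tinv x N n la σ) (signings τ)
      ≈ ι (isPositive la τ ∧ admissible la τ) * rhsTerm q t tinv x N n la τ
  Σ-signings-admissible {τ} τ∈ rewrite isPositive≡not-hasNeg la τ (fillings-shape N la τ∈) with hasNeg τ in negative
  ... | true  = trans (zeroˡ _) (sym (zeroˡ _))
  ... | false = begin
    1# * Σ (λ σ → ι (admissible la σ) * lhsTerm q t tinv x N n la σ) (signings τ)
      ≈⟨ trans (*-identityˡ _) (Σ-cong∈ (signings τ) (λ σ σ∈ →
           *-cong (reflexive (≡.cong ι (admissible-signing la parts≥1 τ σ∈))) refl)) ⟩
    Σ (λ σ → ι (admissible la τ) * lhsTerm q t tinv x N n la σ) (signings τ)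
      ≈⟨ sym (Σ-*ˡ _ _ (signings τ)) ⟩
    ι (admissible la τ) * Σ (lhsTerm q t tinv x N n la) (signings τ)
      ≈⟨ contribution (admissible la τ) ≡.refl ⟩
    ι (admissible la τ) * rhsTerm q t tinv x N n la τ ∎
    where
    contribution : ∀ b → admissible la τ ≡ b →
      ι b * Σ (lhsTerm q t tinv x N n la) (signings τ) ≈ ι b * rhsTerm q t tinv x N n la τ
    contribution false _ = trans (zeroˡ _) (sym (zeroˡ _))
    contribution true  e = *-cong refl (SigningExpansion.Σ-signings-lhsTerm R q t tinv t*tinv≈1 x N n la τ
      (fillings-shape N la τ∈) negative (proj₂ (∧≡true e)) la-antitone Σla≡n)

lemma9p3 : {c ℓ : Level} (R : CommutativeRing c ℓ)
    (q t tinv : CommutativeRing.Carrier R) →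
    CommutativeRing._≈_ R (CommutativeRing._*_ R t tinv) (CommutativeRing.1# R) →
    (x : ℕ → CommutativeRing.Carrier R) (N n : ℕ) (la : List ℕ) →
    IsPartition la → sum la ≡ n →
    CommutativeRing._≈_ R (Gen.LHS R q t tinv x N n la) (Gen.RHS R q t tinv x N n la)
lemma9p3 R q t tinv t*tinv≈1 x N n la (parts≥1 , la-linked) Σla≡n = begin
  Σ lhs (filterᵇ (admissible la) Fs)
    ≈⟨ Σ-filterᵇ lhs (admissible la) Fs ⟩
  Σ (λ σ → ι (admissible la σ) * lhs σ) Fs
    ≈⟨ decompose (fillings-bySign N la) _ ⟩
  Σ (λ τ → ι (not (hasNeg τ)) * Σ (λ σ → ι (admissible la σ) * lhs σ) (signings τ)) Fs
    ≈⟨ Σ-cong∈ Fs (λ τ τ∈ → Σ-signings-admissible R q t tinv t*tinv≈1 x N n la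
                              parts≥1 (linked-≥⇒antitone la-linked) Σla≡n τ∈) ⟩
  Σ (λ τ → ι (isPositive la τ ∧ admissible la τ) * rhs τ) Fs
    ≈⟨ Σ-filterᵇ rhs (λ τ → isPositive la τ ∧ admissible la τ) Fs ⟨
  Σ rhs (filterᵇ (λ τ → isPositive la τ ∧ admissible la τ) Fs) ∎
  where
  open CommutativeRing R
  open Gen R
  open ListSum commutativeSemiring hiding (∑)
  open SumOverSignings R using (decompose; fillings-bySign)
  open import Relation.Binary.Reasoning.Setoid setoid
  Fs = fillings N la
  lhs = lhsTerm q t tinv x N n la
  rhs = rhsTerm q t tinv x N n la
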